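{- For any extended simple processes $A$ and $B$, we have that $A \sqsubseteq_c B$ if and only if $A \sqsubseteq_c^s B$.
   Context: Setting: terms are built over a signature $\Sigma$ from names $\mathcal{N}$, variables $\mathcal{X}$ and handles $\mathcal{W}$, modulo an equational theory $\mathsf{E}$; a ground term $u$ is valid, $\mathit{valid}(u)$, when every subterm of $u$ is $\mathsf{E}$-equal to a term of a fixed set of ground terms $\mathcal{M}$ (containing a public constant). A basic process on channel $c$ is built from $0$, $\mathtt{if}\ u=v\ \mathtt{then}\ P\ \mathtt{else}\ Q$, $\mathtt{in}(c,x).P$, $\mathtt{out}(c,u).P$; a simple process is a multiset of basic processes on pairwise distinct channels; an extended simple process is a pair $(\mathcal{P};\Phi)$ of a simple process and a frame $\Phi$ (a substitution from handles $w\in\mathcal{W}$ to valid ground terms). In the concrete semantics, an input $\mathtt{in}(c,M)$ uses a recipe $M\in\mathcal{T}(\Sigma,\mathrm{dom}(\Phi))$ with $M\Phi$ valid; an output $\mathtt{out}(c,w)$ of a valid term adds $w\triangleright u$ to the frame; tests are silent ($\tau$) and take the then-branch iff both sides are valid and $\mathsf{E}$-equal. Two frames are statically equivalent, $\Phi\sim\Phi'$, if they have the same domain, the same recipes yield valid terms, and the same pairs of valid recipes yield $\mathsf{E}$-equal terms. The compressed semantics $\xrightarrow{\mathsf{tr}}_c$ executes actions in maximal blocks: a proper block is a non-empty sequence of inputs on one channel $c$ followed by a maximal sequence of outputs on $c$ (with $\tau$ actions performed implicitly), after which the basic process must be null, waiting for an input, or blocked on an output of an invalid term; an improper block (a sequence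 of inputs on one channel after which the basic process terminates or is blocked on an output, discarding the whole process) may only occur at the end of a trace. $A \sqsubseteq_c B$ means: for every $\mathsf{tr}$ with $A \xrightarrow{\mathsf{tr}}_c (\mathcal{P}';\Phi')$, there is $(\mathcal{Q}';\Psi')$ with $B \xrightarrow{\mathsf{tr}}_c (\mathcal{Q}';\Psi')$ and $\Phi'\sim\Psi'$. Symbolic side: a constraint system $(\Phi;\mathcal{S})$ contains deduction constraints $D \vdash^? X : x$ (second-order variable $X$ to be instantiated by a recipe over handles $D$ yielding $x$), and equations/disequations $u=^?v$, $u\neq^?v$; a solution $\theta$ maps second-order variables to recipes over the allowed handles such that, with its (unique modulo $\mathsf{E}$) associated first-order substitution $\lambda_\theta$, all deductions hold with valid terms, equations hold between valid terms, disequations hold (or a side is invalid), and $\Phi\lambda_\theta$ is valid; $\mathsf{Sol}$ denotes the set of solutions. The compressed symbolic semantics $\xrightarrow{\mathsf{tr}}_{cs}$ on symbolic processes $(\mathcal{P};\Phi;\mathcal{S})$ mirrors the compressed semantics, with inputs $\mathtt{in}(c,X)$ adding $\mathrm{dom}(\Phi)\vdash^? X:x$, tests adding $u=^?v$ or $u\neq^?v$, and blocked outputs of $u$ adding $u\neq^?u$. $(\mathcal{P};\Phi)\sqsubseteq_c^s(\mathcal{Q};\Psi)$ means: for every $\mathsf{tr}$ with $(\mathcal{P};\Phi;\varnothing)\xrightarrow{\mathsf{tr}}_{cs}(\mathcal{P}';\Phi';\mathcal{S}_A)$ and every $\theta\in\mathsf{Sol}(\Phi';\mathcal{S}_A)$,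 there is $(\mathcal{Q};\Psi;\varnothing)\xrightarrow{\mathsf{tr}}_{cs}(\mathcal{Q}';\Psi';\mathcal{S}_B)$ with $\theta\in\mathsf{Sol}(\Psi';\mathcal{S}_B)$ and $\Phi'\lambda^A_\theta\sim\Psi'\lambda^B_\theta$, where $\lambda^A_\theta,\lambda^B_\theta$ are the first-order substitutions associated to $\theta$ in the respective constraint systems. -}

module Defs where

open import Data.Nat using (ℕ; _≟_)
open import Data.Bool using (if_then_else_)
open import Data.Vec using (Vec; []; _∷_)
open import Data.Vec.Membership.Propositional using () renaming (_∈_ to _∈ᵥ_)
open import Data.Vec.Relation.Binary.Pointwise.Inductive using () renaming (Pointwise to PointwiseV)
open import Data.List using (List; []; _∷_; map; _++_)
open import Data.List.Membership.Propositional using (_∈_; _∉_)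
open import Data.List.Relation.Unary.All using (All)
open import Data.List.Relation.Unary.Unique.Propositional using (Unique)
open import Data.List.Relation.Binary.Pointwise using (Pointwise)
open import Data.Product using (Σ; ∃; ∃-syntax; _×_; _,_; proj₁; proj₂)
open import Data.Sum using (_⊎_)
open import Data.Unit using (⊤)
open import Relation.Nullary using (¬_; does)
open import Relation.Binary.PropositionalEquality using (_≡_; subst; sym)
open import Function.Bundles using (_⇔_)

Name Var Handle Chan SVar : Set
Name   = ℕ
Var    = ℕ
Handle = ℕ
Chan   = ℕ
SVar   = ℕ

record Signature : Set₁ where
  field
    Fun   : Set
    arity : Fun → ℕ

open Signature

data Term (sig : Signature) : Set where
  nm  : Name → Term sig
  var : Var → Term sig
  hdl : Handle → Term sig
  app : (f : Fun sig) → Vec (Term sig) (arity sig f) → Term sig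

module _ {sig : Signature} where

  data Sub (u : Term sig) : Term sig → Set where
    here  : Sub u u
    there : ∀ {f ts t} → t ∈ᵥ ts → Sub u t → Sub u (app f ts)

  Ground : Term sig → Set
  Ground t = (∀ x → ¬ Sub (var x) t) × (∀ w → ¬ Sub (hdl w) t)

  PureT : Term sig → Set
  PureT t = (∀ n → ¬ Sub (nm n) t) × (∀ w → ¬ Sub (hdl w) t)

  Recipe : List Handle → Term sig → Set
  Recipe D M = (∀ n → ¬ Sub (nm n) M) × (∀ x → ¬ Sub (var x) M)
             × (∀ w → Sub (hdl w) M → w ∈ D)

  ren  : (Var → Term sig) → (Handle → Term sig) → Term sig → Term sig
  renV : ∀ {n} → (Var → Term sig) → (Handle → Term sig)
       → Vec (Term sig) n → Vec (Term sig) n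
  ren σ ρ (nm n)     = nm n
  ren σ ρ (var x)    = σ x
  ren σ ρ (hdl w)    = ρ w
  ren σ ρ (app f ts) = app f (renV σ ρ ts)
  renV σ ρ []       = []
  renV σ ρ (t ∷ ts) = ren σ ρ t ∷ renV σ ρ ts

  _⟨_⟩ : Term sig → (Var → Term sig) → Term sig
  t ⟨ σ ⟩ = ren σ hdl t

  _[_↦_] : Term sig → Var → Term sig → Term sig
  t [ x ↦ s ] = t ⟨ (λ y → if does (x ≟ y) then s else var y) ⟩

  -- frames (substitutions from handles to terms), as association lists
  Frame : Set
  Frame = List (Handle × Term sig)

  dom : Frame → List Handle
  dom = map proj₁

  lookupF : Frame → Handle → Term sig
  lookupF []             w = hdl w
  lookupF ((v , t) ∷ Φ) w = if does (v ≟ w) then t else lookupF Φ w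

  _·_ : Term sig → Frame → Term sig
  M · Φ = ren var (lookupF Φ) M

  _⟪_⟫ : Frame → (Var → Term sig) → Frame
  Φ ⟪ σ ⟫ = map (λ p → proj₁ p , proj₂ p ⟨ σ ⟩) Φ

  data Proc : Set where
    nil : Proc
    ite : Term sig → Term sig → Proc → Proc → Proc
    inp : Chan → Var → Proc → Proc
    out : Chan → Term sig → Proc → Proc

  OnChan : Chan → Proc → Set
  OnChan c nil           = ⊤
  OnChan c (ite u v P Q) = OnChan c P × OnChan c Q
  OnChan c (inp d x P)   = d ≡ c × OnChan c P
  OnChan c (out d u P)   = d ≡ c × OnChan c P

  TermWF : List Var → Term sig → Set
  TermWF Γ u = (∀ x → Sub (var x) u → x ∈ Γ) × (∀ w → ¬ Sub (hdl w) u)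

  WF : List Var → Proc → Set
  WF Γ nil           = ⊤
  WF Γ (ite u v P Q) = TermWF Γ u × TermWF Γ v × WF Γ P × WF Γ Q
  WF Γ (inp c x P)   = WF (x ∷ Γ) P
  WF Γ (out c u P)   = TermWF Γ u × WF Γ P

  Closed : Proc → Set
  Closed = WF []

  OccP : Var → Proc → Set
  OccP y nil           = Data.Empty.⊥ where import Data.Empty
  OccP y (ite u v P Q) = Sub (var y) u ⊎ Sub (var y) v ⊎ OccP y P ⊎ OccP y Q
  OccP y (inp c x P)   = y ≡ x ⊎ OccP y P
  OccP y (out c u P)   = Sub (var y) u ⊎ OccP y P

  substP : Var → Term sig → Proc → Proc
  substP x t nil           = nil
  substP x t (ite u v P Q) = ite (u [ x ↦ t ]) (v [ x ↦ t ]) (substP x t P) (substP x t Q)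
  substP x t (inp c y P)   = inp c y (if does (x ≟ y) then P else substP x t P)
  substP x t (out c u P)   = out c (u [ x ↦ t ]) (substP x t P)

record Setting : Set₁ where
  field
    sig      : Signature
    Eqs      : Term sig → Term sig → Set
    Eqs-pure : ∀ l r → Eqs l r → PureT l × PureT r
    𝓜        : Term sig → Set
    𝓜-ground : ∀ u → 𝓜 u → Ground u
    a₀       : Fun sig
    a₀-const : arity sig a₀ ≡ 0
    a₀∈𝓜     : 𝓜 (app a₀ (subst (Vec (Term sig)) (sym a₀-const) []))

module Semantics (𝕊 : Setting) where
  open Setting 𝕊

  T : Set
  T = Term sig

  data _=E_ : T → T → Set where
    E-refl  : ∀ {u} → u =E u
    E-sym   : ∀ {u v} → u =E v → v =E u
    E-trans : ∀ {u v w} → u =E v → v =E w → u =E w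
    E-cong  : ∀ f {us vs} → PointwiseV _=E_ us vs → app f us =E app f vs
    E-ax    : ∀ {l r} → Eqs l r → (σ : Var → T) → (l ⟨ σ ⟩) =E (r ⟨ σ ⟩)

  valid : T → Set
  valid u = ∀ t → Sub t u → ∃[ m ] (𝓜 m × t =E m)

  Ext : Set
  Ext = List (Proc {sig}) × Frame {sig}

  IsSimple : List (Proc {sig}) → Set
  IsSimple Ps = ∃[ cs ] (Pointwise OnChan cs Ps × Unique cs)

  FrameOK : Frame {sig} → Set
  FrameOK Φ = Unique (dom Φ) × All (λ p → Ground (proj₂ p) × valid (proj₂ p)) Φ

  ExtSimple : Ext → Set
  ExtSimple (Ps , Φ) = IsSimple Ps × All Closed Ps × FrameOK Φ

  data Act : Set where
    inA  : Chan → T → Act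
    outA : Chan → Handle → Act

  data _⇒τ_ : Proc {sig} → Proc {sig} → Set where
    τ-refl : ∀ {P} → P ⇒τ P
    τ-then : ∀ {u v P Q R} → valid u → valid v → u =E v → P ⇒τ R → ite u v P Q ⇒τ R
    τ-else : ∀ {u v P Q R} → ¬ (valid u × valid v × u =E v) → Q ⇒τ R → ite u v P Q ⇒τ R

  data Outs : Frame {sig} → Proc {sig} → List Act → Proc {sig} → Frame {sig} → Set where
    o-nil  : ∀ {Φ P} → P ⇒τ nil → Outs Φ P [] nil Φ
    o-in   : ∀ {Φ P c x Q} → P ⇒τ inp c x Q → Outs Φ P [] (inp c x Q) Φ
    o-blk  : ∀ {Φ P c u Q} → P ⇒τ out c u Q → ¬ valid u → Outs Φ P [] (out c u Q) Φ
    o-step : ∀ {Φ P c u Q w tr P' Φ'} → P ⇒τ out c u Q → valid u → w ∉ dom Φ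
           → Outs ((w , u) ∷ Φ) Q tr P' Φ' → Outs Φ P (outA c w ∷ tr) P' Φ'

  data Block : Frame {sig} → Proc {sig} → List Act → Proc {sig} → Frame {sig} → Set where
    b-more : ∀ {Φ P c x Q M tr P' Φ'} → P ⇒τ inp c x Q → Recipe (dom Φ) M → valid (M · Φ)
           → Block Φ (substP x (M · Φ) Q) tr P' Φ' → Block Φ P (inA c M ∷ tr) P' Φ'
    b-last : ∀ {Φ P c x Q M tr P' Φ'} → P ⇒τ inp c x Q → Recipe (dom Φ) M → valid (M · Φ)
           → Outs Φ (substP x (M · Φ) Q) tr P' Φ' → Block Φ P (inA c M ∷ tr) P' Φ'

  data Improper : Frame {sig} → Proc {sig} → List Act → Set where
    i-more : ∀ {Φ P c x Q M tr} → P ⇒τ inp c x Q → Recipe (dom Φ) M → valid (M · Φ)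
           → Improper Φ (substP x (M · Φ) Q) tr → Improper Φ P (inA c M ∷ tr)
    i-last : ∀ {Φ P c x Q M} → P ⇒τ inp c x Q → Recipe (dom Φ) M → valid (M · Φ)
           → ((substP x (M · Φ) Q ⇒τ nil)
              ⊎ ∃[ d ] ∃[ u ] ∃[ R ] (substP x (M · Φ) Q ⇒τ out d u R))
           → Improper Φ P (inA c M ∷ [])

  data _⟶c[_]_ : Ext → List Act → Ext → Set where
    c-done     : ∀ {A} → A ⟶c[ [] ] A
    c-proper   : ∀ {Ls P Rs Φ tr₁ P' Φ₁ tr₂ B}
               → Block Φ P tr₁ P' Φ₁
               → ((Ls ++ P' ∷ Rs) , Φ₁) ⟶c[ tr₂ ] B
               → ((Ls ++ P ∷ Rs) , Φ) ⟶c[ tr₁ ++ tr₂ ] B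
    c-improper : ∀ {Ls P Rs Φ tr}
               → Improper Φ P tr
               → ((Ls ++ P ∷ Rs) , Φ) ⟶c[ tr ] ((Ls ++ Rs) , Φ)

  _∼_ : Frame {sig} → Frame {sig} → Set
  Φ ∼ Ψ = (∀ w → (w ∈ dom Φ) ⇔ (w ∈ dom Ψ))
        × (∀ M → Recipe (dom Φ) M → valid (M · Φ) ⇔ valid (M · Ψ))
        × (∀ M N → Recipe (dom Φ) M → Recipe (dom Φ) N → valid (M · Φ) → valid (N · Φ)
             → ((M · Φ) =E (N · Φ)) ⇔ ((M · Ψ) =E (N · Ψ)))

  _⊑c_ : Ext → Ext → Set
  A ⊑c B = ∀ tr A' → A ⟶c[ tr ] A' → ∃[ B' ] (B ⟶c[ tr ] B' × (proj₂ A' ∼ proj₂ B'))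

  data Constr : Set where
    ded  : List Handle → SVar → Var → Constr
    eqc  : T → T → Constr
    neqc : T → T → Constr

  SVarIn : SVar → Constr → Set
  SVarIn X (ded D Y x) = X ≡ Y
  SVarIn X (eqc u v)   = Data.Empty.⊥ where import Data.Empty
  SVarIn X (neqc u v)  = Data.Empty.⊥ where import Data.Empty

  VarIn : Var → Constr → Set
  VarIn y (ded D X x) = y ≡ x
  VarIn y (eqc u v)   = Sub (var y) u ⊎ Sub (var y) v
  VarIn y (neqc u v)  = Sub (var y) u ⊎ Sub (var y) v

  FreshV : Var → Frame {sig} → List Constr → Proc {sig} → Set
  FreshV y Φ S Q = All (λ p → ¬ Sub (var y) (proj₂ p)) Φ × All (λ C → ¬ VarIn y C) S × ¬ OccP y Q

  FreshSV : SVar → List Constr → Set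
  FreshSV X S = All (λ C → ¬ SVarIn X C) S

  data SAct : Set where
    sinA  : Chan → SVar → SAct
    soutA : Chan → Handle → SAct

  SExt : Set
  SExt = List (Proc {sig}) × Frame {sig} × List Constr

  data _⇒τs_ : Proc {sig} × List Constr → Proc {sig} × List Constr → Set where
    τs-refl : ∀ {C} → C ⇒τs C
    τs-then : ∀ {u v P Q S R} → (P , eqc u v ∷ S) ⇒τs R → (ite u v P Q , S) ⇒τs R
    τs-else : ∀ {u v P Q S R} → (Q , neqc u v ∷ S) ⇒τs R → (ite u v P Q , S) ⇒τs R

  data SOuts : Frame {sig} → List Constr → Proc {sig} → List SAct
             → Proc {sig} → Frame {sig} → List Constr → Set where
    so-nil  : ∀ {Φ S P S'} → (P , S) ⇒τs (nil , S') → SOuts Φ S P [] nil Φ S'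
    so-in   : ∀ {Φ S P c x Q S'} → (P , S) ⇒τs (inp c x Q , S')
            → SOuts Φ S P [] (inp c x Q) Φ S'
    so-blk  : ∀ {Φ S P c u Q S'} → (P , S) ⇒τs (out c u Q , S')
            → SOuts Φ S P [] (out c u Q) Φ (neqc u u ∷ S')
    so-step : ∀ {Φ S P c u Q S' w tr P' Φ' S''} → (P , S) ⇒τs (out c u Q , S') → w ∉ dom Φ
            → SOuts ((w , u) ∷ Φ) S' Q tr P' Φ' S''
            → SOuts Φ S P (soutA c w ∷ tr) P' Φ' S''

  data SBlock : Frame {sig} → List Constr → Proc {sig} → List SAct
              → Proc {sig} → Frame {sig} → List Constr → Set where
    sb-more : ∀ {Φ S P c x Q S₁ X y tr P' Φ' S'}
            → (P , S) ⇒τs (inp c x Q , S₁) → FreshSV X S₁ → FreshV y Φ S₁ Q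
            → SBlock Φ (ded (dom Φ) X y ∷ S₁) (substP x (var y) Q) tr P' Φ' S'
            → SBlock Φ S P (sinA c X ∷ tr) P' Φ' S'
    sb-last : ∀ {Φ S P c x Q S₁ X y tr P' Φ' S'}
            → (P , S) ⇒τs (inp c x Q , S₁) → FreshSV X S₁ → FreshV y Φ S₁ Q
            → SOuts Φ (ded (dom Φ) X y ∷ S₁) (substP x (var y) Q) tr P' Φ' S'
            → SBlock Φ S P (sinA c X ∷ tr) P' Φ' S'

  data SImproper : Frame {sig} → List Constr → Proc {sig} → List SAct → List Constr → Set where
    si-more : ∀ {Φ S P c x Q S₁ X y tr S'}
            → (P , S) ⇒τs (inp c x Q , S₁) → FreshSV X S₁ → FreshV y Φ S₁ Q
            → SImproper Φ (ded (dom Φ) X y ∷ S₁) (substP x (var y) Q) tr S'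
            → SImproper Φ S P (sinA c X ∷ tr) S'
    si-last : ∀ {Φ S P c x Q S₁ X y S'}
            → (P , S) ⇒τs (inp c x Q , S₁) → FreshSV X S₁ → FreshV y Φ S₁ Q
            → (((substP x (var y) Q , ded (dom Φ) X y ∷ S₁) ⇒τs (nil , S'))
               ⊎ ∃[ d ] ∃[ u ] ∃[ R ]
                   ((substP x (var y) Q , ded (dom Φ) X y ∷ S₁) ⇒τs (out d u R , S')))
            → SImproper Φ S P (sinA c X ∷ []) S'

  data _⟶cs[_]_ : SExt → List SAct → SExt → Set where
    cs-done     : ∀ {A} → A ⟶cs[ [] ] A
    cs-proper   : ∀ {Ls P Rs Φ S tr₁ P' Φ₁ S₁ tr₂ B}
                → SBlock Φ S P tr₁ P' Φ₁ S₁
                → ((Ls ++ P' ∷ Rs) , Φ₁ , S₁) ⟶cs[ tr₂ ] B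
                → ((Ls ++ P ∷ Rs) , Φ , S) ⟶cs[ tr₁ ++ tr₂ ] B
    cs-improper : ∀ {Ls P Rs Φ S tr S'}
                → SImproper Φ S P tr S'
                → ((Ls ++ P ∷ Rs) , Φ , S) ⟶cs[ tr ] ((Ls ++ Rs) , Φ , S')

  SatC : Frame {sig} → (SVar → T) → (Var → T) → Constr → Set
  SatC Φ θ λ' (ded D X x) = Recipe D (θ X) × valid (λ' x) × valid (θ X · (Φ ⟪ λ' ⟫))
                          × ((θ X · (Φ ⟪ λ' ⟫)) =E λ' x)
  SatC Φ θ λ' (eqc u v)   = valid (u ⟨ λ' ⟩) × valid (v ⟨ λ' ⟩) × (u ⟨ λ' ⟩) =E (v ⟨ λ' ⟩)
  SatC Φ θ λ' (neqc u v)  = ¬ (valid (u ⟨ λ' ⟩) × valid (v ⟨ λ' ⟩) × (u ⟨ λ' ⟩) =E (v ⟨ λ' ⟩))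

  IsSol : Frame {sig} → List Constr → (SVar → T) → (Var → T) → Set
  IsSol Φ S θ λ' = (∀ x → Ground (λ' x)) × All (SatC Φ θ λ') S
                 × All (λ p → valid (proj₂ p ⟨ λ' ⟩)) Φ

  _⊑cs_ : Ext → Ext → Set
  (P , Φ) ⊑cs (Q , Ψ) =
    ∀ tr P' Φ' SA → (P , Φ , []) ⟶cs[ tr ] (P' , Φ' , SA)
    → ∀ θ λA → IsSol Φ' SA θ λA
    → ∃[ Q' ] ∃[ Ψ' ] ∃[ SB ] ∃[ λB ]
        ((Q , Ψ , []) ⟶cs[ tr ] (Q' , Ψ' , SB) × IsSol Ψ' SB θ λB
         × ((Φ' ⟪ λA ⟫) ∼ (Ψ' ⟪ λB ⟫)))

{-# OPTIONS --safe #-}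

-- Both inclusions are transferred through two properties of the compressed symbolic semantics.
-- Soundness: if θ, with first-order part λ, solves the constraints of a symbolic run, the
-- concrete processes follow the same run when every input X receives the recipe θ X; the
-- concrete state is the symbolic one instantiated by a substitution that agrees with λ up to
-- E-equality of valid terms, so the final frames are statically equivalent.  Completeness: a
-- concrete run whose input recipes are θ X, for pairwise distinct X, is followed symbolically by
-- binding each input to a fresh variable; extending the instantiating substitution by the received
-- messages keeps it a solution of the accumulated constraints, and the frames coincide.
-- For A ⊑c B ⇒ A ⊑cs B, a symbolic run of A is made concrete, answered by B, and B's answer is
-- lifted back with the same θ.  Conversely, the recipes of a concrete run of A are named by
-- distinct second-order variables, the run is lifted, B answers symbolically, and that answer is
-- made concrete.
module Submission where

open import Defs
open import Function using (_∘_; id)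
open import Function.Bundles using (_⇔_; mk⇔; Equivalence)
import Function.Properties.Equivalence as ⇔
open import Data.Nat using (ℕ; suc; _≟_; _⊔_; _≤_; _<_; s≤s)
open import Data.Nat.Properties using (≤-refl; ≤-trans; <⇒≱; <-irrefl; n≤1+n; m≤n⇒m≤n⊔o; m≤n⇒m≤o⊔n)
open import Data.Bool using (true; false; if_then_else_)
open import Data.Unit using (⊤; tt)
open import Data.Empty using (⊥; ⊥-elim)
open import Data.Product using (∃-syntax; _×_; _,_; proj₁; proj₂)
open import Data.Sum using (_⊎_; inj₁; inj₂; [_,_]′)
open import Data.Vec using (Vec; []; _∷_)
open import Data.Vec.Relation.Unary.Any using (here; there)
open import Data.Vec.Membership.Propositional using () renaming (_∈_ to _∈ᵥ_)
open import Data.Vec.Relation.Binary.Pointwise.Inductive using () renaming ([] to []ᵥ; _∷_ to _∷ᵥ_; Pointwise to PointwiseV)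
open import Data.List using (List; []; _∷_; map; _++_)
open import Data.List.Properties using (∷-injective; map-++; ++-assoc)
open import Data.List.Membership.Propositional using (_∈_; _∉_)
open import Data.List.Relation.Binary.Subset.Propositional using (_⊆_)
open import Data.List.Relation.Binary.Subset.Propositional.Properties using (∷⁺ʳ)
open import Data.List.Relation.Binary.Pointwise using (Pointwise; []; _∷_)
open import Data.List.Relation.Unary.Any using (Any; here; there)
import Data.List.Relation.Unary.Any.Properties as Anyₚ
open import Data.List.Relation.Unary.All using (All; []; _∷_)
import Data.List.Relation.Unary.All as All
import Data.List.Relation.Unary.All.Properties as Allₚ
open import Data.List.Relation.Unary.All.Properties using (All¬⇒¬Any)
open import Data.List.Relation.Unary.AllPairs using ([]; _∷_)
import Data.List.Relation.Unary.AllPairs.Properties as APₚ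
open import Data.List.Relation.Unary.Unique.Propositional using (Unique)
open import Relation.Nullary using (¬_; does; yes; no)
open import Relation.Nullary.Decidable using (dec-true; dec-false)
open import Relation.Binary.PropositionalEquality
  using (_≡_; _≢_; refl; sym; trans; cong; cong₂; subst; subst₂; ≢-sym; module ≡-Reasoning)
open ≡-Reasoning

if-≟-≡ : ∀ {A : Set} x (p q : A) → (if does (x ≟ x) then p else q) ≡ p
if-≟-≡ x p q rewrite dec-true (x ≟ x) refl = refl

if-≟-≢ : ∀ {A : Set} {x y} (p q : A) → x ≢ y → (if does (x ≟ y) then p else q) ≡ q
if-≟-≢ {x = x} {y} p q x≢y rewrite dec-false (x ≟ y) x≢y = refl

map-++⁻ : ∀ {A B : Set} (f : A → B) xs {ys zs} → ys ++ zs ≡ map f xs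
        → ∃[ ys' ] ∃[ zs' ] (xs ≡ ys' ++ zs' × ys ≡ map f ys' × zs ≡ map f zs')
map-++⁻ f xs       {[]}     e = [] , xs , refl , refl , e
map-++⁻ f []       {_ ∷ _} ()
map-++⁻ f (x ∷ xs) {y ∷ ys} e with ∷-injective e
... | refl , e' with map-++⁻ f xs {ys} e'
...   | ys' , zs' , refl , refl , refl = x ∷ ys' , zs' , refl , refl , refl

map-++-∷⁻ : ∀ {A B : Set} (f : A → B) xs {ys z zs} → ys ++ z ∷ zs ≡ map f xs
          → ∃[ ys' ] ∃[ z' ] ∃[ zs' ] (xs ≡ ys' ++ z' ∷ zs' × ys ≡ map f ys' × z ≡ f z' × zs ≡ map f zs')
map-++-∷⁻ f xs {ys} {z} {zs} e with map-++⁻ f xs {ys} {z ∷ zs} e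
... | ys' , []      , refl , refl , ()
... | ys' , w ∷ ws , refl , refl , e' with ∷-injective e'
...   | refl , refl = ys' , w , ws , refl , refl , refl , refl

module _ {sig : Signature} where
  private
    T = Term sig
    Pr = Proc {sig}
    Fr = Frame {sig}

  -- Terms

  -- u [ x ↦ s ] of Defs is, by definition, u ⟨ update var x s ⟩.
  update : (Var → T) → Var → T → Var → T
  update σ x t z = if does (x ≟ z) then t else σ z

  update-≡ : ∀ σ x t → update σ x t x ≡ t
  update-≡ σ x t = if-≟-≡ x t (σ x)

  update-≢ : ∀ σ {x z} t → x ≢ z → update σ x t z ≡ σ z
  update-≢ σ t = if-≟-≢ t (σ _)

  update-pointwise : ∀ {P : Var → T → Set} {σ y t} → P y t → (∀ z → P z (σ z)) → ∀ z → P z (update σ y t z)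
  update-pointwise {P} {σ} {y} {t} py pσ z with y ≟ z
  ... | yes refl = subst (P y) (sym (update-≡ σ y t)) py
  ... | no y≢z  = subst (P z) (sym (update-≢ σ t y≢z)) (pσ z)

  update-cong : ∀ σ σ' x t z → (x ≢ z → σ z ≡ σ' z) → update σ x t z ≡ update σ' x t z
  update-cong σ σ' x t z h with x ≟ z
  ... | yes refl = trans (update-≡ σ x t) (sym (update-≡ σ' x t))
  ... | no x≢z  = trans (update-≢ σ t x≢z) (trans (h x≢z) (sym (update-≢ σ' t x≢z)))

  update-var : ∀ x z → update var x (var x) z ≡ var z
  update-var x z with x ≟ z
  ... | yes refl = update-≡ var x (var x)
  ... | no x≢z  = update-≢ var (var x) x≢z

  Sub-trans : {a b c : T} → Sub a b → Sub b c → Sub a c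
  Sub-trans a⊑b here               = a⊑b
  Sub-trans a⊑b (there t∈ts b⊑t) = there t∈ts (Sub-trans a⊑b b⊑t)

  Sub-var : ∀ {a : T} {v} → Sub a (var v) → a ≡ var v
  Sub-var here = refl

  ∈-renV : ∀ {σ ρ n t} {ts : Vec T n} → t ∈ᵥ ts → ren σ ρ t ∈ᵥ renV σ ρ ts
  ∈-renV (here refl) = here refl
  ∈-renV (there t∈ts) = there (∈-renV t∈ts)

  Sub-ren : ∀ {σ ρ} {s t : T} → Sub s t → Sub (ren σ ρ s) (ren σ ρ t)
  Sub-ren here             = here
  Sub-ren (there t∈ts s⊑t) = there (∈-renV t∈ts) (Sub-ren s⊑t)

  ren-ext : ∀ {σ σ' ρ ρ'} (t : T) → (∀ x → Sub (var x) t → σ x ≡ σ' x)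
          → (∀ w → Sub (hdl w) t → ρ w ≡ ρ' w) → ren σ ρ t ≡ ren σ' ρ' t
  renV-ext : ∀ {σ σ' ρ ρ' n} (ts : Vec T n)
           → (∀ x {t} → t ∈ᵥ ts → Sub (var x) t → σ x ≡ σ' x)
           → (∀ w {t} → t ∈ᵥ ts → Sub (hdl w) t → ρ w ≡ ρ' w) → renV σ ρ ts ≡ renV σ' ρ' ts
  ren-ext (nm n)     hσ hρ = refl
  ren-ext (var x)    hσ hρ = hσ x here
  ren-ext (hdl w)    hσ hρ = hρ w here
  ren-ext (app f ts) hσ hρ =
    cong (app f) (renV-ext ts (λ x p s → hσ x (there p s)) (λ w p s → hρ w (there p s)))
  renV-ext []       hσ hρ = refl
  renV-ext (t ∷ ts) hσ hρ =
    cong₂ _∷_ (ren-ext t (λ x → hσ x (here refl)) (λ w → hρ w (here refl)))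
              (renV-ext ts (λ x p → hσ x (there p)) (λ w p → hρ w (there p)))

  ren-∘ : ∀ {σ₁ ρ₁ σ₂ ρ₂} (t : T)
        → ren σ₂ ρ₂ (ren σ₁ ρ₁ t) ≡ ren (ren σ₂ ρ₂ ∘ σ₁) (ren σ₂ ρ₂ ∘ ρ₁) t
  renV-∘ : ∀ {σ₁ ρ₁ σ₂ ρ₂ n} (ts : Vec T n)
         → renV σ₂ ρ₂ (renV σ₁ ρ₁ ts) ≡ renV (ren σ₂ ρ₂ ∘ σ₁) (ren σ₂ ρ₂ ∘ ρ₁) ts
  ren-∘ (nm n)     = refl
  ren-∘ (var x)    = refl
  ren-∘ (hdl w)    = refl
  ren-∘ (app f ts) = cong (app f) (renV-∘ ts)
  renV-∘ []       = refl
  renV-∘ (t ∷ ts) = cong₂ _∷_ (ren-∘ t) (renV-∘ ts)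

  ren-id : (t : T) → ren var hdl t ≡ t
  renV-id : ∀ {n} (ts : Vec T n) → renV var hdl ts ≡ ts
  ren-id (nm n)     = refl
  ren-id (var x)    = refl
  ren-id (hdl w)    = refl
  ren-id (app f ts) = cong (app f) (renV-id ts)
  renV-id []       = refl
  renV-id (t ∷ ts) = cong₂ _∷_ (ren-id t) (renV-id ts)

  data SubOfRen (σ : Var → T) (ρ : Handle → T) (s t : T) : Set where
    in-var : ∀ x → Sub (var x) t → Sub s (σ x) → SubOfRen σ ρ s t
    in-hdl : ∀ w → Sub (hdl w) t → Sub s (ρ w) → SubOfRen σ ρ s t
    image  : ∀ C → Sub C t → s ≡ ren σ ρ C → SubOfRen σ ρ s t

  SubOfRen-mono : ∀ {σ ρ s t t'} → (∀ {a} → Sub a t → Sub a t') → SubOfRen σ ρ s t → SubOfRen σ ρ s t'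
  SubOfRen-mono up (in-var x o q) = in-var x (up o) q
  SubOfRen-mono up (in-hdl w o q) = in-hdl w (up o) q
  SubOfRen-mono up (image C o e)  = image C (up o) e

  Sub-ren⁻ : ∀ {σ ρ s} (t : T) → Sub s (ren σ ρ t) → SubOfRen σ ρ s t
  Sub-renV⁻ : ∀ {σ ρ s n t'} (ts : Vec T n) → t' ∈ᵥ renV σ ρ ts → Sub s t'
            → ∃[ t ] (t ∈ᵥ ts × SubOfRen σ ρ s t)
  Sub-ren⁻ (nm n)     here        = image (nm n) here refl
  Sub-ren⁻ (var x)    s           = in-var x here s
  Sub-ren⁻ (hdl w)    s           = in-hdl w here s
  Sub-ren⁻ (app f ts) here        = image (app f ts) here refl
  Sub-ren⁻ (app f ts) (there p q) with Sub-renV⁻ ts p q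
  ... | t , t∈ts , i = SubOfRen-mono (there t∈ts) i
  Sub-renV⁻ (t ∷ ts) (here refl) q = t , here refl , Sub-ren⁻ t q
  Sub-renV⁻ (t ∷ ts) (there p)   q with Sub-renV⁻ ts p q
  ... | t₀ , t₀∈ts , i = t₀ , there t₀∈ts , i

  data Atom : T → Set where
    var-atom : ∀ x → Atom (var x)
    hdl-atom : ∀ w → Atom (hdl w)

  Sub-atom-ren : ∀ {σ ρ a} (t : T) → Atom a → Sub a (ren σ ρ t)
               → (∃[ x ] (Sub (var x) t × Sub a (σ x))) ⊎ (∃[ w ] (Sub (hdl w) t × Sub a (ρ w)))
  Sub-atom-ren t at s with Sub-ren⁻ t s
  Sub-atom-ren t at s | in-var x o q = inj₁ (x , o , q)
  Sub-atom-ren t at s | in-hdl w o q = inj₂ (w , o , q)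
  Sub-atom-ren t at s | image (var x) o e = inj₁ (x , o , subst (Sub _) e here)
  Sub-atom-ren t at s | image (hdl w) o e = inj₂ (w , o , subst (Sub _) e here)
  Sub-atom-ren t (var-atom _) s | image (nm n) o ()
  Sub-atom-ren t (hdl-atom _) s | image (nm n) o ()
  Sub-atom-ren t (var-atom _) s | image (app f ts) o ()
  Sub-atom-ren t (hdl-atom _) s | image (app f ts) o ()

  NoVars NoHdls : T → Set
  NoVars t = ∀ x → ¬ Sub (var x) t
  NoHdls t = ∀ w → ¬ Sub (hdl w) t

  ground-¬atom : ∀ {a u} → Ground u → Atom a → ¬ Sub a u
  ground-¬atom g (var-atom x) = proj₁ g x
  ground-¬atom g (hdl-atom w) = proj₂ g w

  ground-ren : ∀ {σ ρ} (t : T) → (∀ x → Sub (var x) t → Ground (σ x))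
             → (∀ w → Sub (hdl w) t → Ground (ρ w)) → Ground (ren σ ρ t)
  ground-ren {σ} {ρ} t gσ gρ = (λ x → no-atom (var-atom x)) , (λ w → no-atom (hdl-atom w))
    where
      no-atom : ∀ {a} → Atom a → ¬ Sub a (ren σ ρ t)
      no-atom at s with Sub-atom-ren t at s
      ... | inj₁ (x , o , q) = ground-¬atom (gσ x o) at q
      ... | inj₂ (w , o , q) = ground-¬atom (gρ w o) at q

  noVars-⟨⟩ : ∀ {σ} (u : T) → (∀ z → NoVars (σ z)) → NoVars (u ⟨ σ ⟩)
  noVars-⟨⟩ u nv x s with Sub-atom-ren u (var-atom x) s
  ... | inj₁ (z , _ , q) = nv z x q
  ... | inj₂ (w , _ , ())

  ⟨⟩-ext : ∀ {σ σ'} (u : T) → (∀ x → Sub (var x) u → σ x ≡ σ' x) → u ⟨ σ ⟩ ≡ u ⟨ σ' ⟩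
  ⟨⟩-ext u h = ren-ext u h (λ _ _ → refl)

  ⟨⟩-ground : ∀ {σ} (u : T) → Ground u → u ⟨ σ ⟩ ≡ u
  ⟨⟩-ground u g = trans (⟨⟩-ext u (λ x s → ⊥-elim (proj₁ g x s))) (ren-id u)

  ⟨⟩-update : ∀ {σ y t} (u : T) → ¬ Sub (var y) u → u ⟨ update σ y t ⟩ ≡ u ⟨ σ ⟩
  ⟨⟩-update {σ} {y} {t} u y∉u = ⟨⟩-ext u (λ z s → update-≢ σ {y} t (λ { refl → y∉u s }))

  [↦]-fresh : ∀ {x t} (u : T) → ¬ Sub (var x) u → u [ x ↦ t ] ≡ u
  [↦]-fresh {x} {t} u x∉u =
    trans (⟨⟩-ext u (λ z s → update-≢ var {x} t (λ { refl → x∉u s }))) (ren-id u)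

  maxVar : T → ℕ
  maxVarV : ∀ {n} → Vec T n → ℕ
  maxVar (nm n)     = 0
  maxVar (var x)    = x
  maxVar (hdl w)    = 0
  maxVar (app f ts) = maxVarV ts
  maxVarV []       = 0
  maxVarV (t ∷ ts) = maxVar t ⊔ maxVarV ts

  maxVar-Sub : ∀ {y} (t : T) → Sub (var y) t → y ≤ maxVar t
  maxVarV-Sub : ∀ {y n t} (ts : Vec T n) → t ∈ᵥ ts → Sub (var y) t → y ≤ maxVarV ts
  maxVar-Sub (var x)    here        = ≤-refl
  maxVar-Sub (app f ts) (there p s) = maxVarV-Sub ts p s
  maxVarV-Sub (t ∷ ts) (here refl) s = m≤n⇒m≤n⊔o (maxVarV ts) (maxVar-Sub t s)
  maxVarV-Sub (t ∷ ts) (there p)   s = m≤n⇒m≤o⊔n (maxVar t) (maxVarV-Sub ts p s)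

  -- Processes

  -- Bound variables are mapped to themselves, so capture is only avoided for substitutions
  -- whose range has no variables, which is the only way substᴾ is used.
  substᴾ : (Var → T) → Pr → Pr
  substᴾ σ nil           = nil
  substᴾ σ (ite u v P Q) = ite (u ⟨ σ ⟩) (v ⟨ σ ⟩) (substᴾ σ P) (substᴾ σ Q)
  substᴾ σ (inp c x P)   = inp c x (substᴾ (update σ x (var x)) P)
  substᴾ σ (out c u P)   = out c (u ⟨ σ ⟩) (substᴾ σ P)

  FreeIn : Var → Pr → Set
  FreeIn z nil           = ⊥
  FreeIn z (ite u v P Q) = Sub (var z) u ⊎ Sub (var z) v ⊎ FreeIn z P ⊎ FreeIn z Q
  FreeIn z (inp c x P)   = z ≢ x × FreeIn z P
  FreeIn z (out c u P)   = Sub (var z) u ⊎ FreeIn z P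

  FreeIn-WF : ∀ {Γ z} P → WF Γ P → FreeIn z P → z ∈ Γ
  FreeIn-WF (ite u v P Q) (wu , _ , _ , _) (inj₁ s)                = proj₁ wu _ s
  FreeIn-WF (ite u v P Q) (_ , wv , _ , _) (inj₂ (inj₁ s))         = proj₁ wv _ s
  FreeIn-WF (ite u v P Q) (_ , _ , wP , _) (inj₂ (inj₂ (inj₁ f))) = FreeIn-WF P wP f
  FreeIn-WF (ite u v P Q) (_ , _ , _ , wQ) (inj₂ (inj₂ (inj₂ f))) = FreeIn-WF Q wQ f
  FreeIn-WF (inp c x P)   wP               (z≢x , f) with FreeIn-WF P wP f
  ... | here z≡x  = ⊥-elim (z≢x z≡x)
  ... | there z∈Γ = z∈Γ
  FreeIn-WF (out c u P)   (wu , _)         (inj₁ s)                = proj₁ wu _ s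
  FreeIn-WF (out c u P)   (_ , wP)         (inj₂ f)                = FreeIn-WF P wP f

  FreeIn⇒OccP : ∀ {z} P → FreeIn z P → OccP z P
  FreeIn⇒OccP (ite u v P Q) (inj₁ s)                = inj₁ s
  FreeIn⇒OccP (ite u v P Q) (inj₂ (inj₁ s))         = inj₂ (inj₁ s)
  FreeIn⇒OccP (ite u v P Q) (inj₂ (inj₂ (inj₁ f))) = inj₂ (inj₂ (inj₁ (FreeIn⇒OccP P f)))
  FreeIn⇒OccP (ite u v P Q) (inj₂ (inj₂ (inj₂ f))) = inj₂ (inj₂ (inj₂ (FreeIn⇒OccP Q f)))
  FreeIn⇒OccP (inp c x P)   (_ , f)                 = inj₂ (FreeIn⇒OccP P f)
  FreeIn⇒OccP (out c u P)   (inj₁ s)                = inj₁ s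
  FreeIn⇒OccP (out c u P)   (inj₂ f)                = inj₂ (FreeIn⇒OccP P f)

  private
    ite-cong : ∀ {u u' v v' : T} {P P' Q Q'} → u ≡ u' → v ≡ v' → P ≡ P' → Q ≡ Q'
             → ite u v P Q ≡ ite u' v' P' Q'
    ite-cong refl refl refl refl = refl

  substᴾ-ext : ∀ {σ σ'} P → (∀ z → FreeIn z P → σ z ≡ σ' z) → substᴾ σ P ≡ substᴾ σ' P
  substᴾ-ext nil           h = refl
  substᴾ-ext (ite u v P Q) h =
    ite-cong (⟨⟩-ext u (λ z → h z ∘ inj₁)) (⟨⟩-ext v (λ z → h z ∘ inj₂ ∘ inj₁))
             (substᴾ-ext P (λ z → h z ∘ inj₂ ∘ inj₂ ∘ inj₁))
             (substᴾ-ext Q (λ z → h z ∘ inj₂ ∘ inj₂ ∘ inj₂))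
  substᴾ-ext {σ} {σ'} (inp c x P) h =
    cong (inp c x) (substᴾ-ext P (λ z f → update-cong σ σ' x (var x) z (λ x≢z → h z (≢-sym x≢z , f))))
  substᴾ-ext (out c u P)   h = cong₂ (out c) (⟨⟩-ext u (λ z → h z ∘ inj₁)) (substᴾ-ext P (λ z → h z ∘ inj₂))

  substᴾ-var : ∀ P → substᴾ var P ≡ P
  substᴾ-var nil           = refl
  substᴾ-var (ite u v P Q) = ite-cong (ren-id u) (ren-id v) (substᴾ-var P) (substᴾ-var Q)
  substᴾ-var (inp c x P)   =
    cong (inp c x) (trans (substᴾ-ext P (λ z _ → update-var x z)) (substᴾ-var P))
  substᴾ-var (out c u P)   = cong₂ (out c) (ren-id u) (substᴾ-var P)

  substᴾ-closed : ∀ σ P → Closed P → substᴾ σ P ≡ P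
  substᴾ-closed σ P closed =
    trans (substᴾ-ext P (λ z f → ⊥-elim (∉[] (FreeIn-WF P closed f)))) (substᴾ-var P)
    where
      ∉[] : ∀ {z : Var} → z ∉ []
      ∉[] ()

  -- The hypotheses of substP-fresh in a form that is preserved under binders (Splits-under).
  record Splits (x y : Var) (t : T) (σ₀ σ₁ : Var → T) : Set where
    field
      σ₀-x   : σ₀ x ≡ var x
      σ₀-¬x  : ∀ z → z ≢ x → ¬ Sub (var x) (σ₀ z)
      σ₁-y   : σ₁ y ≡ t
      σ₁-σ₀  : ∀ z → z ≢ x → z ≢ y → σ₁ z ≡ σ₀ z

  Splits-under : ∀ {x y t σ₀ σ₁} x' → x ≢ x' → y ≢ x' → Splits x y t σ₀ σ₁
               → Splits x y t (update σ₀ x' (var x')) (update σ₁ x' (var x'))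
  Splits-under {x} {y} {t} {σ₀} {σ₁} x' x≢x' y≢x' sp = record
    { σ₀-x  = trans (update-≢ σ₀ (var x') (≢-sym x≢x')) σ₀-x
    ; σ₀-¬x = ¬x
    ; σ₁-y  = trans (update-≢ σ₁ (var x') (≢-sym y≢x')) σ₁-y
    ; σ₁-σ₀ = λ z z≢x z≢y → update-cong σ₁ σ₀ x' (var x') z (λ _ → σ₁-σ₀ z z≢x z≢y)
    }
    where
      open Splits sp
      ¬x : ∀ z → z ≢ x → ¬ Sub (var x) (update σ₀ x' (var x') z)
      ¬x z z≢x s with x' ≟ z
      ... | no x'≢z  = σ₀-¬x z z≢x (subst (Sub (var x)) (update-≢ σ₀ (var x') x'≢z) s)
      ... | yes refl with Sub-var (subst (Sub (var x)) (update-≡ σ₀ x' (var x')) s)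
      ...   | refl = x≢x' refl

  [↦]-split : ∀ {x y t σ₀ σ₁} (u : T) → ¬ Sub (var y) u → Splits x y t σ₀ σ₁
            → (u ⟨ σ₀ ⟩) [ x ↦ t ] ≡ (u [ x ↦ var y ]) ⟨ σ₁ ⟩
  [↦]-split {x} {y} {t} {σ₀} {σ₁} u y∉u sp =
    trans (ren-∘ u) (trans (ren-ext u pointwise (λ _ _ → refl)) (sym (ren-∘ u)))
    where
      open Splits sp
      pointwise : ∀ z → Sub (var z) u → (σ₀ z) [ x ↦ t ] ≡ (update var x (var y) z) ⟨ σ₁ ⟩
      pointwise z s with x ≟ z
      ... | yes refl = begin
        σ₀ x [ x ↦ t ]                  ≡⟨ cong (_[ x ↦ t ]) σ₀-x ⟩
        update var x t x                ≡⟨ update-≡ var x t ⟩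
        t                               ≡⟨ σ₁-y ⟨
        σ₁ y                            ≡⟨ cong (_⟨ σ₁ ⟩) (update-≡ var x (var y)) ⟨
        update var x (var y) x ⟨ σ₁ ⟩  ∎
      ... | no x≢z = begin
        σ₀ z [ x ↦ t ]                  ≡⟨ [↦]-fresh (σ₀ z) (σ₀-¬x z (≢-sym x≢z)) ⟩
        σ₀ z                            ≡⟨ σ₁-σ₀ z (≢-sym x≢z) (λ { refl → y∉u s }) ⟨
        σ₁ z                            ≡⟨ cong (_⟨ σ₁ ⟩) (update-≢ var (var y) x≢z) ⟨
        update var x (var y) z ⟨ σ₁ ⟩  ∎

  substP-split : ∀ {x y t σ₀ σ₁} Q → ¬ OccP y Q → Splits x y t σ₀ σ₁
               → substP x t (substᴾ σ₀ Q) ≡ substᴾ σ₁ (substP x (var y) Q)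
  substP-split nil           y∉Q sp = refl
  substP-split (ite u v P Q) y∉Q sp =
    ite-cong ([↦]-split u (y∉Q ∘ inj₁) sp) ([↦]-split v (y∉Q ∘ inj₂ ∘ inj₁) sp)
             (substP-split P (y∉Q ∘ inj₂ ∘ inj₂ ∘ inj₁) sp)
             (substP-split Q (y∉Q ∘ inj₂ ∘ inj₂ ∘ inj₂) sp)
  substP-split (out c u P)   y∉Q sp =
    cong₂ (out c) ([↦]-split u (y∉Q ∘ inj₁) sp) (substP-split P (y∉Q ∘ inj₂) sp)
  substP-split {x} {y} {t} {σ₀} {σ₁} (inp c x' P) y∉Q sp with x ≟ x'
  ... | yes refl = cong (inp c x) (begin
    _                               ≡⟨ if-≟-≡ x _ _ ⟩
    substᴾ (update σ₀ x (var x)) P  ≡⟨ substᴾ-ext P same ⟩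
    substᴾ (update σ₁ x (var x)) P  ≡⟨ cong (substᴾ _) (if-≟-≡ x P _) ⟨
    _                               ∎)
    where
      same : ∀ z → FreeIn z P → update σ₀ x (var x) z ≡ update σ₁ x (var x) z
      same z f = update-cong σ₀ σ₁ x (var x) z λ x≢z →
        sym (Splits.σ₁-σ₀ sp z (≢-sym x≢z) (λ { refl → y∉Q (inj₂ (FreeIn⇒OccP P f)) }))
  ... | no x≢x' = cong (inp c x') (begin
    _                                ≡⟨ if-≟-≢ _ _ x≢x' ⟩
    substP x t (substᴾ σ₀' P)        ≡⟨ substP-split P (y∉Q ∘ inj₂) (Splits-under x' x≢x' (y∉Q ∘ inj₁) sp) ⟩
    substᴾ σ₁' (substP x (var y) P)  ≡⟨ cong (substᴾ σ₁') (if-≟-≢ P _ x≢x') ⟨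
    _                                ∎)
    where
      σ₀' = update σ₀ x' (var x')
      σ₁' = update σ₁ x' (var x')

  substP-fresh : ∀ {σ x y t} Q → (∀ z → NoVars (σ z)) → ¬ OccP y Q
               → substP x t (substᴾ (update σ x (var x)) Q) ≡ substᴾ (update σ y t) (substP x (var y) Q)
  substP-fresh {σ} {x} {y} {t} Q σ-noVars y∉Q = substP-split Q y∉Q record
    { σ₀-x  = update-≡ σ x (var x)
    ; σ₀-¬x = λ z z≢x → subst (λ s → ¬ Sub (var x) s) (sym (update-≢ σ (var x) (≢-sym z≢x))) (σ-noVars z x)
    ; σ₁-y  = update-≡ σ y t
    ; σ₁-σ₀ = λ z z≢x z≢y → trans (update-≢ σ t (≢-sym z≢y)) (sym (update-≢ σ (var x) (≢-sym z≢x)))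
    }

  TermWF-mono : ∀ {Γ Γ'} (u : T) → Γ ⊆ Γ' → TermWF Γ u → TermWF Γ' u
  TermWF-mono u Γ⊆Γ' (wu , nh) = (λ x → Γ⊆Γ' ∘ wu x) , nh

  WF-mono : ∀ {Γ Γ'} P → Γ ⊆ Γ' → WF Γ P → WF Γ' P
  WF-mono nil           Γ⊆Γ' _                 = tt
  WF-mono (ite u v P Q) Γ⊆Γ' (wu , wv , wP , wQ) =
    TermWF-mono u Γ⊆Γ' wu , TermWF-mono v Γ⊆Γ' wv , WF-mono P Γ⊆Γ' wP , WF-mono Q Γ⊆Γ' wQ
  WF-mono (inp c x P)   Γ⊆Γ' wP                = WF-mono P (∷⁺ʳ x Γ⊆Γ') wP
  WF-mono (out c u P)   Γ⊆Γ' (wu , wP)         = TermWF-mono u Γ⊆Γ' wu , WF-mono P Γ⊆Γ' wP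

  Sub-rename : ∀ {a : T} {x y z} → Sub a (update var x (var y) z) → (x ≡ z × a ≡ var y) ⊎ (x ≢ z × a ≡ var z)
  Sub-rename {x = x} {y} {z} s with x ≟ z
  ... | yes refl = inj₁ (refl , Sub-var (subst (Sub _) (update-≡ var x (var y)) s))
  ... | no x≢z  = inj₂ (x≢z , Sub-var (subst (Sub _) (update-≢ var (var y) x≢z) s))

  TermWF-rename : ∀ {Γ Γ' x y} (u : T) → TermWF Γ u → (∀ {z} → z ∈ Γ → z ≢ x → z ∈ Γ') → y ∈ Γ'
                → TermWF Γ' (u [ x ↦ var y ])
  TermWF-rename {Γ} {Γ'} {x} {y} u (wu , nh) h y∈Γ' = vars , hdls
    where
      vars : ∀ z → Sub (var z) (u [ x ↦ var y ]) → z ∈ Γ'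
      vars z s with Sub-atom-ren u (var-atom z) s
      ... | inj₂ (_ , _ , ())
      ... | inj₁ (z' , o , q) with Sub-rename {x = x} q
      ...   | inj₁ (_ , refl)    = y∈Γ'
      ...   | inj₂ (x≢z' , refl) = h (wu z' o) (≢-sym x≢z')
      hdls : ∀ w → ¬ Sub (hdl w) (u [ x ↦ var y ])
      hdls w s with Sub-atom-ren u (hdl-atom w) s
      ... | inj₂ (w' , o , _) = nh w' o
      ... | inj₁ (_ , _ , q) with Sub-rename {x = x} q
      ...   | inj₁ (_ , ())
      ...   | inj₂ (_ , ())

  WF-rename : ∀ {Γ Γ' x y} Q → WF Γ Q → (∀ {z} → z ∈ Γ → z ≢ x → z ∈ Γ') → y ∈ Γ'
            → WF Γ' (substP x (var y) Q)
  WF-rename nil           _                   h y∈Γ' = tt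
  WF-rename (ite u v P Q) (wu , wv , wP , wQ) h y∈Γ' =
    TermWF-rename u wu h y∈Γ' , TermWF-rename v wv h y∈Γ' , WF-rename P wP h y∈Γ' , WF-rename Q wQ h y∈Γ'
  WF-rename (out c u P)   (wu , wP)           h y∈Γ' = TermWF-rename u wu h y∈Γ' , WF-rename P wP h y∈Γ'
  WF-rename {Γ} {Γ'} {x} {y} (inp c x' P) wP h y∈Γ' with x ≟ x'
  ... | yes refl = subst (WF (x ∷ Γ')) (sym (if-≟-≡ x P _)) (WF-mono P bound wP)
    where
      bound : x ∷ Γ ⊆ x ∷ Γ'
      bound (here z≡x)  = here z≡x
      bound {z} (there z∈Γ) with z ≟ x
      ... | yes z≡x = here z≡x
      ... | no z≢x  = there (h z∈Γ z≢x)
  ... | no x≢x' = subst (WF (x' ∷ Γ')) (sym (if-≟-≢ P _ x≢x')) (WF-rename P wP h' (there y∈Γ'))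
    where
      h' : ∀ {z} → z ∈ x' ∷ Γ → z ≢ x → z ∈ x' ∷ Γ'
      h' (here z≡x')  _   = here z≡x'
      h' (there z∈Γ) z≢x = there (h z∈Γ z≢x)

  substᴾ-nil⁻ : ∀ {σ} P → substᴾ σ P ≡ nil → P ≡ nil
  substᴾ-nil⁻ nil           refl = refl
  substᴾ-nil⁻ (ite _ _ _ _) ()
  substᴾ-nil⁻ (inp _ _ _)   ()
  substᴾ-nil⁻ (out _ _ _)   ()

  substᴾ-inp⁻ : ∀ {σ c x Qc} P → substᴾ σ P ≡ inp c x Qc
              → ∃[ Q ] (P ≡ inp c x Q × Qc ≡ substᴾ (update σ x (var x)) Q)
  substᴾ-inp⁻ (inp c x Q)   refl = Q , refl , refl
  substᴾ-inp⁻ nil           ()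
  substᴾ-inp⁻ (ite _ _ _ _) ()
  substᴾ-inp⁻ (out _ _ _)   ()

  substᴾ-out⁻ : ∀ {σ c u Qc} P → substᴾ σ P ≡ out c u Qc
              → ∃[ u' ] ∃[ Q ] (P ≡ out c u' Q × u ≡ u' ⟨ σ ⟩ × Qc ≡ substᴾ σ Q)
  substᴾ-out⁻ (out c u Q)   refl = u , Q , refl , refl , refl
  substᴾ-out⁻ nil           ()
  substᴾ-out⁻ (ite _ _ _ _) ()
  substᴾ-out⁻ (inp _ _ _)   ()

  maxVarᴾ : Proc {sig} → ℕ
  maxVarᴾ nil           = 0
  maxVarᴾ (ite u v P Q) = maxVar u ⊔ maxVar v ⊔ maxVarᴾ P ⊔ maxVarᴾ Q
  maxVarᴾ (inp c x P)   = x ⊔ maxVarᴾ P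
  maxVarᴾ (out c u P)   = maxVar u ⊔ maxVarᴾ P

  maxVarᴾ-OccP : ∀ {y} P → OccP y P → y ≤ maxVarᴾ P
  maxVarᴾ-OccP (ite u v P Q) (inj₁ s) =
    m≤n⇒m≤n⊔o _ (m≤n⇒m≤n⊔o _ (m≤n⇒m≤n⊔o _ (maxVar-Sub u s)))
  maxVarᴾ-OccP (ite u v P Q) (inj₂ (inj₁ s)) =
    m≤n⇒m≤n⊔o _ (m≤n⇒m≤n⊔o _ (m≤n⇒m≤o⊔n (maxVar u) (maxVar-Sub v s)))
  maxVarᴾ-OccP (ite u v P Q) (inj₂ (inj₂ (inj₁ o))) =
    m≤n⇒m≤n⊔o _ (m≤n⇒m≤o⊔n (maxVar u ⊔ maxVar v) (maxVarᴾ-OccP P o))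
  maxVarᴾ-OccP (ite u v P Q) (inj₂ (inj₂ (inj₂ o))) =
    m≤n⇒m≤o⊔n (maxVar u ⊔ maxVar v ⊔ maxVarᴾ P) (maxVarᴾ-OccP Q o)
  maxVarᴾ-OccP (inp c x P) (inj₁ refl) = m≤n⇒m≤n⊔o (maxVarᴾ P) ≤-refl
  maxVarᴾ-OccP (inp c x P) (inj₂ o)    = m≤n⇒m≤o⊔n x (maxVarᴾ-OccP P o)
  maxVarᴾ-OccP (out c u P) (inj₁ s)    = m≤n⇒m≤n⊔o (maxVarᴾ P) (maxVar-Sub u s)
  maxVarᴾ-OccP (out c u P) (inj₂ o)    = m≤n⇒m≤o⊔n (maxVar u) (maxVarᴾ-OccP P o)

  -- Frames

  dom-⟪⟫ : ∀ (Φ : Fr) σ → dom (Φ ⟪ σ ⟫) ≡ dom Φ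
  dom-⟪⟫ []      σ = refl
  dom-⟪⟫ (p ∷ Φ) σ = cong (proj₁ p ∷_) (dom-⟪⟫ Φ σ)

  lookupF-⟪⟫ : ∀ (Φ : Fr) σ w → lookupF (Φ ⟪ σ ⟫) w ≡ lookupF Φ w ⟨ σ ⟩
  lookupF-⟪⟫ []             σ w = refl
  lookupF-⟪⟫ ((v , t) ∷ Φ) σ w with does (v ≟ w)
  ... | true  = refl
  ... | false = lookupF-⟪⟫ Φ σ w

  Recipe-mono : ∀ {D D'} {M : T} → D ⊆ D' → Recipe D M → Recipe D' M
  Recipe-mono D⊆D' (nn , nv , hs) = nn , nv , λ w → D⊆D' ∘ hs w

  noVars-·⟪⟫ : ∀ {D M σ} (Φ : Fr) → Recipe D M → (∀ z → NoVars (σ z)) → NoVars (M · (Φ ⟪ σ ⟫))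
  noVars-·⟪⟫ {M = M} {σ} Φ (_ , nv , _) σ-noVars x s with Sub-atom-ren M (var-atom x) s
  ... | inj₁ (x' , o , _) = nv x' o
  ... | inj₂ (w , _ , q)  = noVars-⟨⟩ (lookupF Φ w) σ-noVars x (subst (Sub (var x)) (lookupF-⟪⟫ Φ σ w) q)

  GroundFrame : Fr → Set
  GroundFrame = All (Ground ∘ proj₂)

  lookupF-ground : ∀ {Φ : Fr} → GroundFrame Φ → ∀ {w} → w ∈ dom Φ → Ground (lookupF Φ w)
  lookupF-ground {(v , t) ∷ Φ} (g ∷ gs) {w} w∈ with v ≟ w
  ... | yes refl = subst Ground (sym (if-≟-≡ v t _)) g
  ... | no v≢w  = subst Ground (sym (if-≟-≢ t _ v≢w)) (lookupF-ground gs (tail w∈))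
    where
      tail : w ∈ v ∷ dom Φ → w ∈ dom Φ
      tail (here w≡v)  = ⊥-elim (v≢w (sym w≡v))
      tail (there w∈) = w∈

  ground-· : ∀ {M : T} {Φ} → Recipe (dom Φ) M → GroundFrame Φ → Ground (M · Φ)
  ground-· {M} (_ , nv , hs) g =
    ground-ren M (λ x s → ⊥-elim (nv x s)) (λ w s → lookupF-ground g (hs w s))

  ground-⟨⟩ : ∀ {σ} (u : T) → NoHdls u → (∀ z → Ground (σ z)) → Ground (u ⟨ σ ⟩)
  ground-⟨⟩ u nh g = ground-ren u (λ x _ → g x) (λ w s → ⊥-elim (nh w s))

  ground-⟪⟫ : ∀ {σ} (Φ : Fr) → All (NoHdls ∘ proj₂) Φ → (∀ z → Ground (σ z)) → GroundFrame (Φ ⟪ σ ⟫)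
  ground-⟪⟫ []            []        g = []
  ground-⟪⟫ ((w , u) ∷ Φ) (nh ∷ nhs) g = ground-⟨⟩ u nh g ∷ ground-⟪⟫ Φ nhs g

  ⟪⟫-ground : ∀ {σ} (Φ : Fr) → GroundFrame Φ → Φ ⟪ σ ⟫ ≡ Φ
  ⟪⟫-ground []            []       = refl
  ⟪⟫-ground ((w , u) ∷ Φ) (g ∷ gs) = cong₂ _∷_ (cong (w ,_) (⟨⟩-ground u g)) (⟪⟫-ground Φ gs)

  ⟪⟫-update : ∀ {σ y t} (Φ : Fr) → All (λ p → ¬ Sub (var y) (proj₂ p)) Φ
            → Φ ⟪ update σ y t ⟫ ≡ Φ ⟪ σ ⟫
  ⟪⟫-update []            []           = refl
  ⟪⟫-update ((w , u) ∷ Φ) (y∉u ∷ y∉Φ) = cong₂ _∷_ (cong (w ,_) (⟨⟩-update u y∉u)) (⟪⟫-update Φ y∉Φ)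

  infix 4 _≼ᶠ_
  data _≼ᶠ_ : Fr → Fr → Set where
    ≼-refl : ∀ {Φ} → Φ ≼ᶠ Φ
    ≼-cons : ∀ {Φ Φ' w u} → w ∉ dom Φ' → Φ ≼ᶠ Φ' → Φ ≼ᶠ (w , u) ∷ Φ'

  ≼-trans : ∀ {Φ₁ Φ₂ Φ₃} → Φ₁ ≼ᶠ Φ₂ → Φ₂ ≼ᶠ Φ₃ → Φ₁ ≼ᶠ Φ₃
  ≼-trans ext ≼-refl          = ext
  ≼-trans ext (≼-cons w∉ ext') = ≼-cons w∉ (≼-trans ext ext')

  ≼-dom : ∀ {Φ Φ'} → Φ ≼ᶠ Φ' → dom Φ ⊆ dom Φ'
  ≼-dom ≼-refl          = id
  ≼-dom (≼-cons _ ext) = there ∘ ≼-dom ext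

  ≼-lookupF : ∀ {Φ Φ'} → Φ ≼ᶠ Φ' → ∀ {w} → w ∈ dom Φ → lookupF Φ' w ≡ lookupF Φ w
  ≼-lookupF ≼-refl                             w∈ = refl
  ≼-lookupF (≼-cons {Φ' = Φ'} {v} {u} v∉ ext) {w} w∈ =
    trans (if-≟-≢ {x = v} u (lookupF Φ' w) (λ { refl → v∉ (≼-dom ext w∈) })) (≼-lookupF ext w∈)

  ≼-⟪⟫ : ∀ {Φ Φ'} σ → Φ ≼ᶠ Φ' → Φ ⟪ σ ⟫ ≼ᶠ Φ' ⟪ σ ⟫
  ≼-⟪⟫ σ ≼-refl                      = ≼-refl
  ≼-⟪⟫ σ (≼-cons {Φ' = Φ'} w∉ ext) = ≼-cons (subst (_ ∉_) (sym (dom-⟪⟫ Φ' σ)) w∉) (≼-⟪⟫ σ ext)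

  ≼-All : ∀ {P : Handle × T → Set} {Φ Φ'} → Φ ≼ᶠ Φ' → All P Φ' → All P Φ
  ≼-All ≼-refl          ps       = ps
  ≼-All (≼-cons _ ext) (_ ∷ ps) = ≼-All ext ps

  ·-≼ : ∀ {D M Φ Φ'} → Recipe D M → D ⊆ dom Φ → Φ ≼ᶠ Φ' → M · Φ' ≡ M · Φ
  ·-≼ {M = M} (_ , _ , hs) D⊆Φ ext = ren-ext M (λ _ _ → refl) (λ w s → ≼-lookupF ext (D⊆Φ (hs w s)))

  maxVarᶠ : Fr → ℕ
  maxVarᶠ []      = 0
  maxVarᶠ (p ∷ Φ) = maxVar (proj₂ p) ⊔ maxVarᶠ Φ

  maxVarᶠ-fresh : ∀ {y} (Φ : Fr) → maxVarᶠ Φ < y → All (λ p → ¬ Sub (var y) (proj₂ p)) Φ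
  maxVarᶠ-fresh []            _  = []
  maxVarᶠ-fresh ((w , t) ∷ Φ) lt =
      (λ s → <⇒≱ lt (m≤n⇒m≤n⊔o (maxVarᶠ Φ) (maxVar-Sub t s)))
    ∷ maxVarᶠ-fresh Φ (≤-trans (s≤s (m≤n⇒m≤o⊔n (maxVar t) ≤-refl)) lt)

module _ (𝕊 : Setting) where
  open Setting 𝕊
  open Semantics 𝕊
  private
    Fr = Frame {sig}
    Pr = Proc {sig}

  -- Validity and static equivalence

  ≡⇒=E : ∀ {a b} → a ≡ b → a =E b
  ≡⇒=E refl = E-refl

  -- E-equality does not transfer validity, so a concrete value is related to its symbolic
  -- counterpart by being either identical to it or valid and E-equal to a valid term.
  infix 4 _≋_ _≋ˢ_ _≋ᶠ_
  _≋_ : T → T → Set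
  a ≋ b = a ≡ b ⊎ (a =E b × valid a × valid b)

  ≋⇒=E : ∀ {a b} → a ≋ b → a =E b
  ≋⇒=E (inj₁ refl)        = E-refl
  ≋⇒=E (inj₂ (a=b , _)) = a=b

  ≋-sym : ∀ {a b} → a ≋ b → b ≋ a
  ≋-sym (inj₁ refl)            = inj₁ refl
  ≋-sym (inj₂ (a=b , va , vb)) = inj₂ (E-sym a=b , vb , va)

  valid-Sub : ∀ {s t} → Sub s t → valid t → valid s
  valid-Sub s⊑t vt r r⊑s = vt r (Sub-trans r⊑s s⊑t)

  =E-ren : ∀ {σ σ' ρ ρ'} (t : T) → (∀ x → Sub (var x) t → σ x =E σ' x)
         → (∀ w → Sub (hdl w) t → ρ w =E ρ' w) → ren σ ρ t =E ren σ' ρ' t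
  =E-renV : ∀ {σ σ' ρ ρ' n} (ts : Vec T n) → (∀ x {t} → t ∈ᵥ ts → Sub (var x) t → σ x =E σ' x)
          → (∀ w {t} → t ∈ᵥ ts → Sub (hdl w) t → ρ w =E ρ' w) → PointwiseV _=E_ (renV σ ρ ts) (renV σ' ρ' ts)
  =E-ren (nm n)     hσ hρ = E-refl
  =E-ren (var x)    hσ hρ = hσ x here
  =E-ren (hdl w)    hσ hρ = hρ w here
  =E-ren (app f ts) hσ hρ = E-cong f (=E-renV ts (λ x p → hσ x ∘ there p) (λ w p → hρ w ∘ there p))
  =E-renV []       hσ hρ = []ᵥ
  =E-renV (t ∷ ts) hσ hρ = =E-ren t (λ x → hσ x (here refl)) (λ w → hρ w (here refl))
                       ∷ᵥ =E-renV ts (λ x p → hσ x (there p)) (λ w p → hρ w (there p))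

  valid-≋ : ∀ {a b} → a ≋ b → valid a → valid b
  valid-≋ (inj₁ refl)          va = va
  valid-≋ (inj₂ (_ , _ , vb)) _  = vb

  -- A subterm of the new term lies below the image of an atom, or is the image of an old
  -- subterm and hence E-equal to a subterm of the old term.
  valid-ren : ∀ {σ σ' ρ ρ'} (t : T) → (∀ x → Sub (var x) t → σ x ≋ σ' x)
            → (∀ w → Sub (hdl w) t → ρ w ≋ ρ' w) → valid (ren σ ρ t) → valid (ren σ' ρ' t)
  valid-ren {σ} {σ'} {ρ} {ρ'} t hσ hρ vt s s⊑ with Sub-ren⁻ {σ = σ'} {ρ = ρ'} t s⊑
  ... | in-var x o q = valid-≋ (hσ x o) (valid-Sub (Sub-ren o) vt) s q
  ... | in-hdl w o q = valid-≋ (hρ w o) (valid-Sub (Sub-ren o) vt) s q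
  ... | image C o refl with vt (ren σ ρ C) (Sub-ren o)
  ...   | m , m∈𝓜 , C=m = m , m∈𝓜 , E-trans (E-sym C=C') C=m
    where
      C=C' : ren σ ρ C =E ren σ' ρ' C
      C=C' = =E-ren C (λ x q → ≋⇒=E (hσ x (Sub-trans q o))) (λ w q → ≋⇒=E (hρ w (Sub-trans q o)))

  _≋ˢ_ : (Var → T) → (Var → T) → Set
  σ ≋ˢ σ' = ∀ z → σ z ≋ σ' z

  ≋ˢ-sym : ∀ {σ σ'} → σ ≋ˢ σ' → σ' ≋ˢ σ
  ≋ˢ-sym σ≋σ' = ≋-sym ∘ σ≋σ'

  valid-⟨⟩ : ∀ {σ σ'} → σ ≋ˢ σ' → (u : T) → valid (u ⟨ σ ⟩) → valid (u ⟨ σ' ⟩)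
  valid-⟨⟩ σ≋σ' u = valid-ren u (λ x _ → σ≋σ' x) (λ _ _ → inj₁ refl)

  =E-⟨⟩ : ∀ {σ σ'} → σ ≋ˢ σ' → (u : T) → (u ⟨ σ ⟩) =E (u ⟨ σ' ⟩)
  =E-⟨⟩ σ≋σ' u = =E-ren u (λ x _ → ≋⇒=E (σ≋σ' x)) (λ _ _ → E-refl)

  _≋ᶠ_ : Fr → Fr → Set
  _≋ᶠ_ = Pointwise (λ p q → proj₁ p ≡ proj₁ q × proj₂ p ≋ proj₂ q)

  ≋ᶠ-sym : ∀ {Φ Ψ} → Φ ≋ᶠ Ψ → Ψ ≋ᶠ Φ
  ≋ᶠ-sym []               = []
  ≋ᶠ-sym ((v≡w , a≋b) ∷ rs) = (sym v≡w , ≋-sym a≋b) ∷ ≋ᶠ-sym rs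

  ≋ᶠ-dom : ∀ {Φ Ψ} → Φ ≋ᶠ Ψ → dom Φ ≡ dom Ψ
  ≋ᶠ-dom []               = refl
  ≋ᶠ-dom ((v≡w , _) ∷ rs) = cong₂ _∷_ v≡w (≋ᶠ-dom rs)

  ≋ᶠ-lookupF : ∀ {Φ Ψ} → Φ ≋ᶠ Ψ → ∀ w → lookupF Φ w ≋ lookupF Ψ w
  ≋ᶠ-lookupF []                                           w = inj₁ refl
  ≋ᶠ-lookupF {(v , _) ∷ _} {(.v , _) ∷ _} ((refl , a≋b) ∷ rs) w with does (v ≟ w)
  ... | true  = a≋b
  ... | false = ≋ᶠ-lookupF rs w

  valid-· : ∀ {Φ Ψ} → Φ ≋ᶠ Ψ → ∀ M → valid (M · Φ) → valid (M · Ψ)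
  valid-· Φ≋Ψ M = valid-ren M (λ _ _ → inj₁ refl) (λ w _ → ≋ᶠ-lookupF Φ≋Ψ w)

  =E-· : ∀ {Φ Ψ} → Φ ≋ᶠ Ψ → ∀ M → (M · Φ) =E (M · Ψ)
  =E-· Φ≋Ψ M = =E-ren M (λ _ _ → E-refl) (λ w _ → ≋⇒=E (≋ᶠ-lookupF Φ≋Ψ w))

  ⟪⟫-≋ᶠ : ∀ {σ λ'} (Φ : Fr) → σ ≋ˢ λ' → All (λ p → valid (proj₂ p ⟨ λ' ⟩)) Φ
        → Φ ⟪ σ ⟫ ≋ᶠ Φ ⟪ λ' ⟫
  ⟪⟫-≋ᶠ []            σ≋λ []         = []
  ⟪⟫-≋ᶠ ((w , u) ∷ Φ) σ≋λ (vu ∷ vΦ) =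
    (refl , inj₂ (=E-⟨⟩ σ≋λ u , valid-⟨⟩ (≋ˢ-sym σ≋λ) u vu , vu)) ∷ ⟪⟫-≋ᶠ Φ σ≋λ vΦ

  ≋ᶠ⇒∼ : ∀ {Φ Ψ} → Φ ≋ᶠ Ψ → Φ ∼ Ψ
  ≋ᶠ⇒∼ {Φ} Φ≋Ψ =
      (λ w → subst (λ D → (w ∈ dom Φ) ⇔ (w ∈ D)) (≋ᶠ-dom Φ≋Ψ) ⇔.refl)
    , (λ M _ → mk⇔ (valid-· Φ≋Ψ M) (valid-· (≋ᶠ-sym Φ≋Ψ) M))
    , (λ M N _ _ _ _ → mk⇔ (λ e → E-trans (E-sym (=E-· Φ≋Ψ M)) (E-trans e (=E-· Φ≋Ψ N)))
                           (λ e → E-trans (=E-· Φ≋Ψ M) (E-trans e (E-sym (=E-· Φ≋Ψ N)))))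

  ∼-trans : ∀ {Φ Ψ Χ} → Φ ∼ Ψ → Ψ ∼ Χ → Φ ∼ Χ
  ∼-trans {Φ} {Ψ} (dom₁ , valid₁ , eq₁) (dom₂ , valid₂ , eq₂) =
      (λ w → ⇔.trans (dom₁ w) (dom₂ w))
    , (λ M r → ⇔.trans (valid₁ M r) (valid₂ M (over r)))
    , (λ M N r r' vM vN → ⇔.trans (eq₁ M N r r' vM vN)
        (eq₂ M N (over r) (over r') (Equivalence.to (valid₁ M r) vM) (Equivalence.to (valid₁ N r') vN)))
    where
      over : ∀ {M} → Recipe (dom Φ) M → Recipe (dom Ψ) M
      over = Recipe-mono (Equivalence.to (dom₁ _))

  -- Symbolic runs

  dedVars : List Constr → List Var
  dedVars []                = []
  dedVars (ded D X x ∷ S)  = x ∷ dedVars S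
  dedVars (eqc u v ∷ S)    = dedVars S
  dedVars (neqc u v ∷ S)   = dedVars S

  infix 4 _⊴_
  _⊴_ : List Constr → List Constr → Set
  S ⊴ S' = ∃[ N ] (S' ≡ N ++ S)

  ⊴-refl : ∀ {S} → S ⊴ S
  ⊴-refl = [] , refl

  ⊴-step : ∀ {S S'} C → S ⊴ S' → S ⊴ C ∷ S'
  ⊴-step C (N , refl) = C ∷ N , refl

  ⊴-trans : ∀ {S₁ S₂ S₃} → S₁ ⊴ S₂ → S₂ ⊴ S₃ → S₁ ⊴ S₃
  ⊴-trans (N , refl) (M , refl) = M ++ N , sym (++-assoc M N _)

  ⊴-All : ∀ {P : Constr → Set} {S S'} → S ⊴ S' → All P S' → All P S
  ⊴-All (N , refl) = Allₚ.++⁻ʳ N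

  ⊴-dedVars : ∀ {S S'} → S ⊴ S' → dedVars S ⊆ dedVars S'
  ⊴-dedVars (N , refl) = prefix N
    where
      prefix : ∀ N {S} → dedVars S ⊆ dedVars (N ++ S)
      prefix []                = id
      prefix (ded D X x ∷ N)  = there ∘ prefix N
      prefix (eqc u v ∷ N)    = prefix N
      prefix (neqc u v ∷ N)   = prefix N

  fresh-∉dedVars : ∀ {y} S → All (λ C → ¬ VarIn y C) S → y ∉ dedVars S
  fresh-∉dedVars (ded D X x ∷ S) (y≢x ∷ _)   (here y≡x) = y≢x y≡x
  fresh-∉dedVars (ded D X x ∷ S) (_ ∷ fresh) (there y∈) = fresh-∉dedVars S fresh y∈
  fresh-∉dedVars (eqc u v ∷ S)   (_ ∷ fresh) y∈         = fresh-∉dedVars S fresh y∈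
  fresh-∉dedVars (neqc u v ∷ S)  (_ ∷ fresh) y∈         = fresh-∉dedVars S fresh y∈

  ⇒τs-⊴ : ∀ {A B} → A ⇒τs B → proj₂ A ⊴ proj₂ B
  ⇒τs-⊴ τs-refl    = ⊴-refl
  ⇒τs-⊴ (τs-then d) = ⊴-trans (⊴-step _ ⊴-refl) (⇒τs-⊴ d)
  ⇒τs-⊴ (τs-else d) = ⊴-trans (⊴-step _ ⊴-refl) (⇒τs-⊴ d)

  ⇒τs-All : ∀ {P : Constr → Set} → (∀ u v → P (eqc u v)) → (∀ u v → P (neqc u v))
          → ∀ {A B} → A ⇒τs B → All P (proj₂ A) → All P (proj₂ B)
  ⇒τs-All pe pn τs-refl                     ps = ps
  ⇒τs-All pe pn (τs-then {u = u} {v} d) ps = ⇒τs-All pe pn d (pe u v ∷ ps)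
  ⇒τs-All pe pn (τs-else {u = u} {v} d) ps = ⇒τs-All pe pn d (pn u v ∷ ps)

  ⇒τs-WF : ∀ {A B} → A ⇒τs B → WF (dedVars (proj₂ A)) (proj₁ A) → WF (dedVars (proj₂ B)) (proj₁ B)
  ⇒τs-WF τs-refl     wf                  = wf
  ⇒τs-WF (τs-then d) (_ , _ , wP , _) = ⇒τs-WF d wP
  ⇒τs-WF (τs-else d) (_ , _ , _ , wQ) = ⇒τs-WF d wQ

  SOuts-ext : ∀ {Φ S P str P' Φ' S'} → SOuts Φ S P str P' Φ' S' → Φ ≼ᶠ Φ' × S ⊴ S'
  SOuts-ext (so-nil d)         = ≼-refl , ⇒τs-⊴ d
  SOuts-ext (so-in d)          = ≼-refl , ⇒τs-⊴ d
  SOuts-ext (so-blk d)         = ≼-refl , ⊴-step _ (⇒τs-⊴ d)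
  SOuts-ext (so-step d w∉ o) with SOuts-ext o
  ... | ext , suf = ≼-trans (≼-cons w∉ ≼-refl) ext , ⊴-trans (⇒τs-⊴ d) suf

  SBlock-ext : ∀ {Φ S P str P' Φ' S'} → SBlock Φ S P str P' Φ' S' → Φ ≼ᶠ Φ' × S ⊴ S'
  SBlock-ext (sb-more d _ _ b) with SBlock-ext b
  ... | ext , suf = ext , ⊴-trans (⇒τs-⊴ d) (⊴-trans (⊴-step _ ⊴-refl) suf)
  SBlock-ext (sb-last d _ _ o) with SOuts-ext o
  ... | ext , suf = ext , ⊴-trans (⇒τs-⊴ d) (⊴-trans (⊴-step _ ⊴-refl) suf)

  SEnd : Proc {sig} × List Constr → List Constr → Set
  SEnd A S' = (A ⇒τs (nil , S')) ⊎ ∃[ c ] ∃[ u ] ∃[ R ] (A ⇒τs (out c u R , S'))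

  SEnd-⊴ : ∀ {A S'} → SEnd A S' → proj₂ A ⊴ S'
  SEnd-⊴ (inj₁ d)                 = ⇒τs-⊴ d
  SEnd-⊴ (inj₂ (_ , _ , _ , d)) = ⇒τs-⊴ d

  SImproper-⊴ : ∀ {Φ S P str S'} → SImproper Φ S P str S' → S ⊴ S'
  SImproper-⊴ (si-more d _ _ i)   = ⊴-trans (⇒τs-⊴ d) (⊴-trans (⊴-step _ ⊴-refl) (SImproper-⊴ i))
  SImproper-⊴ (si-last d _ _ end) = ⊴-trans (⇒τs-⊴ d) (⊴-trans (⊴-step _ ⊴-refl) (SEnd-⊴ end))

  ⟶cs-ext : ∀ {Ps Φ S str Ps' Φ' S'} → (Ps , Φ , S) ⟶cs[ str ] (Ps' , Φ' , S') → Φ ≼ᶠ Φ' × S ⊴ S'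
  ⟶cs-ext cs-done = ≼-refl , ⊴-refl
  ⟶cs-ext (cs-proper b tr) with SBlock-ext b | ⟶cs-ext tr
  ... | ext , suf | ext' , suf' = ≼-trans ext ext' , ⊴-trans suf suf'
  ⟶cs-ext (cs-improper i) = ≼-refl , SImproper-⊴ i

  SOuts-WF : ∀ {Φ S P str P' Φ' S'} → SOuts Φ S P str P' Φ' S' → WF (dedVars S) P → WF (dedVars S') P'
  SOuts-WF (so-nil d)       _  = tt
  SOuts-WF (so-in d)        wf = ⇒τs-WF d wf
  SOuts-WF (so-blk d)       wf = ⇒τs-WF d wf
  SOuts-WF (so-step d _ o) wf = SOuts-WF o (proj₂ (⇒τs-WF d wf))

  maxVarᶜ : List Constr → ℕ
  maxVarᶜ []               = 0
  maxVarᶜ (ded D X x ∷ S) = x ⊔ maxVarᶜ S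
  maxVarᶜ (eqc u v ∷ S)   = maxVar u ⊔ maxVar v ⊔ maxVarᶜ S
  maxVarᶜ (neqc u v ∷ S)  = maxVar u ⊔ maxVar v ⊔ maxVarᶜ S

  private
    pair-fresh : ∀ {y} (u v : T) {m} → maxVar u ⊔ maxVar v ⊔ m < y → ¬ (Sub (var y) u ⊎ Sub (var y) v)
    pair-fresh u v {m} lt =
      [ (λ s → <⇒≱ lt (m≤n⇒m≤n⊔o m (m≤n⇒m≤n⊔o (maxVar v) (maxVar-Sub u s))))
      , (λ s → <⇒≱ lt (m≤n⇒m≤n⊔o m (m≤n⇒m≤o⊔n (maxVar u) (maxVar-Sub v s)))) ]′

  maxVarᶜ-fresh : ∀ {y} S → maxVarᶜ S < y → All (λ C → ¬ VarIn y C) S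
  maxVarᶜ-fresh []               _  = []
  maxVarᶜ-fresh (ded D X x ∷ S) lt =
    (λ { refl → <⇒≱ lt (m≤n⇒m≤n⊔o _ ≤-refl) })
    ∷ maxVarᶜ-fresh S (≤-trans (s≤s (m≤n⇒m≤o⊔n x ≤-refl)) lt)
  maxVarᶜ-fresh (eqc u v ∷ S)   lt =
    pair-fresh u v {maxVarᶜ S} lt ∷ maxVarᶜ-fresh S (≤-trans (s≤s (m≤n⇒m≤o⊔n _ ≤-refl)) lt)
  maxVarᶜ-fresh (neqc u v ∷ S)  lt =
    pair-fresh u v {maxVarᶜ S} lt ∷ maxVarᶜ-fresh S (≤-trans (s≤s (m≤n⇒m≤o⊔n _ ≤-refl)) lt)

  freshVar : Fr → List Constr → Pr → Var
  freshVar Φ S Q = suc (maxVarᶠ Φ ⊔ maxVarᶜ S ⊔ maxVarᴾ Q)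

  freshVar-FreshV : ∀ Φ S Q → FreshV (freshVar Φ S Q) Φ S Q
  freshVar-FreshV Φ S Q =
      maxVarᶠ-fresh Φ (s≤s (m≤n⇒m≤n⊔o (maxVarᴾ Q) (m≤n⇒m≤n⊔o (maxVarᶜ S) ≤-refl)))
    , maxVarᶜ-fresh S (s≤s (m≤n⇒m≤n⊔o (maxVarᴾ Q) (m≤n⇒m≤o⊔n (maxVarᶠ Φ) ≤-refl)))
    , (λ o → <⇒≱ (s≤s (m≤n⇒m≤o⊔n (maxVarᶠ Φ ⊔ maxVarᶜ S) ≤-refl)) (maxVarᴾ-OccP Q o))

  -- A deduction constraint only mentions handles already in the frame, so it stays satisfied as the
  -- frame grows (SatC-≼).
  Scoped : Fr → Constr → Set
  Scoped Φ (ded D X x) = D ⊆ dom Φ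
  Scoped Φ (eqc u v)   = ⊤
  Scoped Φ (neqc u v)  = ⊤

  Scoped-≼ : ∀ {Φ Φ'} → Φ ≼ᶠ Φ' → ∀ C → Scoped Φ C → Scoped Φ' C
  Scoped-≼ ext (ded D X x) D⊆Φ = ≼-dom ext ∘ D⊆Φ
  Scoped-≼ ext (eqc u v)   _   = tt
  Scoped-≼ ext (neqc u v)  _   = tt

  inputVars : List SAct → List SVar
  inputVars []                  = []
  inputVars (sinA c X ∷ str)  = X ∷ inputVars str
  inputVars (soutA c w ∷ str) = inputVars str

  FreshInputs : List SAct → List Constr → Set
  FreshInputs str S = Unique (inputVars str) × All (λ X → FreshSV X S) (inputVars str)

  FreshSV-τ : ∀ {X A B} → A ⇒τs B → FreshSV X (proj₂ A) → FreshSV X (proj₂ B)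
  FreshSV-τ = ⇒τs-All (λ _ _ ()) (λ _ _ ())

  FreshInputs-mono : ∀ {S S'} str → (∀ {X} → FreshSV X S → FreshSV X S') → FreshInputs str S → FreshInputs str S'
  FreshInputs-mono str mono (uniq , fresh) = uniq , All.map mono fresh

  Declares : SVar → List Constr → Set
  Declares X = Any (SVarIn X)

  Declares-⊴ : ∀ {X S S'} → S ⊴ S' → Declares X S → Declares X S'
  Declares-⊴ (N , refl) = Anyₚ.++⁺ʳ N

  inputVars-++ : ∀ str str' → inputVars (str ++ str') ≡ inputVars str ++ inputVars str'
  inputVars-++ []                  str' = refl
  inputVars-++ (sinA c X ∷ str)  str' = cong (X ∷_) (inputVars-++ str str')
  inputVars-++ (soutA c w ∷ str) str' = inputVars-++ str str'

  SOuts-inputVars : ∀ {Φ S P str P' Φ' S'} → SOuts Φ S P str P' Φ' S' → inputVars str ≡ []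
  SOuts-inputVars (so-nil _)       = refl
  SOuts-inputVars (so-in _)        = refl
  SOuts-inputVars (so-blk _)       = refl
  SOuts-inputVars (so-step _ _ o) = SOuts-inputVars o

  private
    fresh-after-input : ∀ {c X y D S₁ S} → S ⊴ S₁ → ∀ str → FreshSV X S₁
                      → FreshInputs str (ded D X y ∷ S₁) → FreshInputs (sinA c X ∷ str) S
    fresh-after-input suf str fX (uniq , fresh) =
        All.map (λ fZ X≡Z → All.head fZ (sym X≡Z)) fresh ∷ uniq
      , ⊴-All suf fX ∷ All.map (⊴-All suf ∘ All.tail) fresh

  SBlock-FreshInputs : ∀ {Φ S P str P' Φ' S'} → SBlock Φ S P str P' Φ' S'
                     → FreshInputs str S × All (λ X → Declares X S') (inputVars str)
  SBlock-FreshInputs (sb-more {Φ} {c = c} {y = y} {tr = str} d fX _ b) with SBlock-FreshInputs b | SBlock-ext b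
  ... | fresh , declared | _ , suf =
    fresh-after-input {c = c} {y = y} {D = dom Φ} (⇒τs-⊴ d) str fX fresh , Declares-⊴ suf (here refl) ∷ declared
  SBlock-FreshInputs (sb-last d fX _ o) with SOuts-ext o
  ... | _ , suf rewrite SOuts-inputVars o = ([] ∷ [] , ⊴-All (⇒τs-⊴ d) fX ∷ []) , Declares-⊴ suf (here refl) ∷ []

  SImproper-FreshInputs : ∀ {Φ S P str S'} → SImproper Φ S P str S' → FreshInputs str S
  SImproper-FreshInputs (si-more {Φ} {c = c} {y = y} {tr = str} d fX _ i) =
    fresh-after-input {c = c} {y = y} {D = dom Φ} (⇒τs-⊴ d) str fX (SImproper-FreshInputs i)
  SImproper-FreshInputs (si-last d fX _ _) = [] ∷ [] , ⊴-All (⇒τs-⊴ d) fX ∷ []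

  ⟶cs-FreshInputs : ∀ {Ps Φ S str B} → (Ps , Φ , S) ⟶cs[ str ] B → FreshInputs str S
  ⟶cs-FreshInputs cs-done = [] , []
  ⟶cs-FreshInputs (cs-proper {tr₁ = str₁} {tr₂ = str₂} b rest)
    with SBlock-FreshInputs b | ⟶cs-FreshInputs rest | SBlock-ext b
  ... | (uniq₁ , fresh₁) , declared | uniq₂ , fresh₂ | _ , suf rewrite inputVars-++ str₁ str₂ =
      APₚ.++⁺ uniq₁ uniq₂
        (All.map (λ dX → All.map (λ fZ X≡Z → All¬⇒¬Any fZ (subst (λ V → Declares V _) X≡Z dX)) fresh₂) declared)
    , Allₚ.++⁺ fresh₁ (All.map (⊴-All suf) fresh₂)
  ⟶cs-FreshInputs (cs-improper i) = SImproper-FreshInputs i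

  -- Matching symbolic and concrete steps

  ⇒τs-sound : ∀ {A B} → A ⇒τs B → ∀ {Φ θ λ' σ} → All (SatC Φ θ λ') (proj₂ B) → σ ≋ˢ λ'
            → substᴾ σ (proj₁ A) ⇒τ substᴾ σ (proj₁ B)
  ⇒τs-sound τs-refl sat σ≋λ = τ-refl
  ⇒τs-sound (τs-then {u = u} {v} d) sat σ≋λ with ⊴-All (⇒τs-⊴ d) sat
  ... | (vu , vv , u=v) ∷ _ =
    τ-then (valid-⟨⟩ λ≋σ u vu) (valid-⟨⟩ λ≋σ v vv) (E-trans (=E-⟨⟩ σ≋λ u) (E-trans u=v (=E-⟨⟩ λ≋σ v)))
           (⇒τs-sound d sat σ≋λ)
    where λ≋σ = ≋ˢ-sym σ≋λ
  ⇒τs-sound (τs-else {u = u} {v} d) sat σ≋λ with ⊴-All (⇒τs-⊴ d) sat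
  ... | u≠v ∷ _ =
    τ-else (λ (vu , vv , u=v) → u≠v (valid-⟨⟩ σ≋λ u vu , valid-⟨⟩ σ≋λ v vv ,
                                      E-trans (=E-⟨⟩ λ≋σ u) (E-trans u=v (=E-⟨⟩ σ≋λ v))))
           (⇒τs-sound d sat σ≋λ)
    where λ≋σ = ≋ˢ-sym σ≋λ

  ⇒τ-complete : ∀ {Pc R} → Pc ⇒τ R → ∀ {Φ θ σ} P S → Pc ≡ substᴾ σ P → All (SatC Φ θ σ) S
              → ∃[ P' ] ∃[ S' ] ((P , S) ⇒τs (P' , S') × R ≡ substᴾ σ P' × All (SatC Φ θ σ) S')
  ⇒τ-complete τ-refl P S refl sat = P , S , τs-refl , refl , sat
  ⇒τ-complete (τ-then vu vv u=v d) (ite u v P Q) S refl sat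
    with ⇒τ-complete d P (eqc u v ∷ S) refl ((vu , vv , u=v) ∷ sat)
  ... | P' , S' , ds , R≡ , sat' = P' , S' , τs-then ds , R≡ , sat'
  ⇒τ-complete (τ-else u≠v d) (ite u v P Q) S refl sat
    with ⇒τ-complete d Q (neqc u v ∷ S) refl (u≠v ∷ sat)
  ... | P' , S' , ds , R≡ , sat' = P' , S' , τs-else ds , R≡ , sat'
  ⇒τ-complete (τ-then _ _ _ _) nil         S () _
  ⇒τ-complete (τ-then _ _ _ _) (inp _ _ _) S () _
  ⇒τ-complete (τ-then _ _ _ _) (out _ _ _) S () _
  ⇒τ-complete (τ-else _ _)     nil         S () _
  ⇒τ-complete (τ-else _ _)     (inp _ _ _) S () _
  ⇒τ-complete (τ-else _ _)     (out _ _ _) S () _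

  fresh-input : ∀ {P S c x Q S₁ y σ t} Φ → (P , S) ⇒τs (inp c x Q , S₁) → FreshV y Φ S₁ Q
              → (∀ z → NoVars (σ z)) → WF (dedVars S) P
              → (substP x t (substᴾ (update σ x (var x)) Q) ≡ substᴾ (update σ y t) (substP x (var y) Q))
              × (Φ ⟪ update σ y t ⟫ ≡ Φ ⟪ σ ⟫)
              × (∀ z → z ∈ dedVars S → update σ y t z ≡ σ z)
              × WF (y ∷ dedVars S₁) (substP x (var y) Q)
  fresh-input {Q = Q} {y = y} {σ} {t} Φ d (y∉Φ , y∉S₁ , y∉Q) σ-noVars wf =
      substP-fresh Q σ-noVars y∉Q
    , ⟪⟫-update Φ y∉Φ
    , (λ z z∈S → update-≢ σ {y} t (λ { refl → fresh-∉dedVars _ y∉S₁ (⊴-dedVars (⇒τs-⊴ d) z∈S) }))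
    , WF-rename Q (⇒τs-WF d wf) (λ { (here z≡x) z≢x → ⊥-elim (z≢x z≡x) ; (there z∈) _ → there z∈ }) (here refl)

  map-substᴾ-agree : ∀ {Γ σ σ'} → (∀ z → z ∈ Γ → σ' z ≡ σ z) → ∀ {Ps : List Pr} → All (WF Γ) Ps
                   → map (substᴾ σ') Ps ≡ map (substᴾ σ) Ps
  map-substᴾ-agree agree []                 = refl
  map-substᴾ-agree agree {P ∷ _} (wP ∷ wPs) =
    cong₂ _∷_ (substᴾ-ext P (λ z f → agree z (FreeIn-WF P wP f))) (map-substᴾ-agree agree wPs)

  map-substᴾ-replace : ∀ {Γ σ σ'} Ls {P P' : Pr} {Rs} → (∀ z → z ∈ Γ → σ' z ≡ σ z)
                     → All (WF Γ) (Ls ++ P ∷ Rs)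
                     → map (substᴾ σ') (Ls ++ P' ∷ Rs) ≡ map (substᴾ σ) Ls ++ substᴾ σ' P' ∷ map (substᴾ σ) Rs
  map-substᴾ-replace {σ' = σ'} Ls {P' = P'} {Rs} agree wf with Allₚ.++⁻ Ls wf
  ... | wLs , _ ∷ wRs =
    trans (map-++ (substᴾ σ') Ls (P' ∷ Rs))
          (cong₂ (λ A B → A ++ substᴾ σ' P' ∷ B) (map-substᴾ-agree agree wLs) (map-substᴾ-agree agree wRs))

  WF-replace : ∀ {Γ Γ'} Ls {P P' : Pr} {Rs} → Γ ⊆ Γ' → All (WF Γ) (Ls ++ P ∷ Rs) → WF Γ' P'
             → All (WF Γ') (Ls ++ P' ∷ Rs)
  WF-replace Ls Γ⊆Γ' wf wP' with Allₚ.++⁻ Ls wf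
  ... | wLs , _ ∷ wRs = Allₚ.++⁺ (All.map (λ {Q} → WF-mono Q Γ⊆Γ') wLs)
                                 (wP' ∷ All.map (λ {Q} → WF-mono Q Γ⊆Γ') wRs)

  instAct : (SVar → T) → SAct → Act
  instAct θ (sinA c X)  = inA c (θ X)
  instAct θ (soutA c w) = outA c w

  Outs-cast : ∀ {Φ Φ' P P' tr Q Ψ} → Φ ≡ Φ' → P ≡ P' → Outs Φ P tr Q Ψ → Outs Φ' P' tr Q Ψ
  Outs-cast refl refl o = o

  Block-cast : ∀ {Φ Φ' P P' tr Q Ψ} → Φ ≡ Φ' → P ≡ P' → Block Φ P tr Q Ψ → Block Φ' P' tr Q Ψ
  Block-cast refl refl b = b

  Improper-cast : ∀ {Φ Φ' P P' tr} → Φ ≡ Φ' → P ≡ P' → Improper Φ P tr → Improper Φ' P' tr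
  Improper-cast refl refl i = i

  -- A symbolic state (P, Φs) is matched by the concrete state (substᴾ σ P, Φs ⟪ σ ⟫) with σ ≋ˢ λ'
  -- rather than σ = λ', because an input receives θ X · (Φs ⟪ σ ⟫), which is only E-equal to λ' y.
  module Soundness (θ : SVar → T) (λ' : Var → T) (Φf : Fr) (Sf : List Constr) (sol : IsSol Φf Sf θ λ') where

    Tracks : (Var → T) → Set
    Tracks σ = σ ≋ˢ λ' × (∀ z → NoVars (σ z))

    satisfied : ∀ {S} → S ⊴ Sf → All (SatC Φf θ λ') S
    satisfied suf = ⊴-All suf (proj₁ (proj₂ sol))

    frame-valid : ∀ {Φ} → Φ ≼ᶠ Φf → All (λ p → valid (proj₂ p ⟨ λ' ⟩)) Φ
    frame-valid ext = ≼-All ext (proj₂ (proj₂ sol))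

    outs-sound : ∀ {Φs S P str P' Φs' S'} → SOuts Φs S P str P' Φs' S' → Φs' ≼ᶠ Φf → S' ⊴ Sf
               → ∀ {σ} → σ ≋ˢ λ'
               → Outs (Φs ⟪ σ ⟫) (substᴾ σ P) (map (instAct θ) str) (substᴾ σ P') (Φs' ⟪ σ ⟫)
    outs-sound (so-nil d) _ suf σ≋λ = o-nil (⇒τs-sound d (satisfied suf) σ≋λ)
    outs-sound (so-in d)  _ suf σ≋λ = o-in (⇒τs-sound d (satisfied suf) σ≋λ)
    outs-sound (so-blk {u = u} d) _ suf σ≋λ with satisfied suf
    ... | u≠u ∷ sat = o-blk (⇒τs-sound d sat σ≋λ) λ vu →
      let vu' = valid-⟨⟩ σ≋λ u vu in u≠u (vu' , vu' , E-refl)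
    outs-sound {Φs} (so-step {u = u} {w = w} d w∉ o) ext suf {σ} σ≋λ with SOuts-ext o
    ... | ext₀ , suf₀ with frame-valid (≼-trans ext₀ ext)
    ...   | vu ∷ _ =
      o-step (⇒τs-sound d (satisfied (⊴-trans suf₀ suf)) σ≋λ) (valid-⟨⟩ (≋ˢ-sym σ≋λ) u vu)
             (w∉ ∘ subst (w ∈_) (dom-⟪⟫ Φs σ)) (outs-sound o ext suf σ≋λ)

    input-sound : ∀ {Φs S P c x Q S₁ X y σ} → (P , S) ⇒τs (inp c x Q , S₁)
                → Φs ≼ᶠ Φf → ded (dom Φs) X y ∷ S₁ ⊴ Sf → Tracks σ
                → (substᴾ σ P ⇒τ inp c x (substᴾ (update σ x (var x)) Q))
                × Recipe (dom (Φs ⟪ σ ⟫)) (θ X) × valid (θ X · (Φs ⟪ σ ⟫))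
                × Tracks (update σ y (θ X · (Φs ⟪ σ ⟫)))
    input-sound {Φs} {X = X} {y} {σ} d ext suf (σ≋λ , σ-noVars) with satisfied suf
    ... | (recipe , vλy , vθX , θX=λy) ∷ sat =
        ⇒τs-sound d sat σ≋λ , recipe' , vt
      , update-pointwise {P = λ z s → s ≋ λ' z} {y = y} (inj₂ (t=λy , vt , vλy)) σ≋λ
      , update-pointwise {P = λ _ → NoVars} {y = y} (noVars-·⟪⟫ Φs recipe σ-noVars) σ-noVars
      where
        recipe' : Recipe (dom (Φs ⟪ σ ⟫)) (θ X)
        recipe' = Recipe-mono (λ {w} → subst (w ∈_) (sym (dom-⟪⟫ Φs σ))) recipe
        Φσ≋Φλ : Φs ⟪ σ ⟫ ≋ᶠ Φs ⟪ λ' ⟫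
        Φσ≋Φλ = ⟪⟫-≋ᶠ Φs σ≋λ (frame-valid ext)
        stable : θ X · (Φf ⟪ λ' ⟫) ≡ θ X · (Φs ⟪ λ' ⟫)
        stable = ·-≼ recipe (λ {w} → subst (w ∈_) (sym (dom-⟪⟫ Φs λ'))) (≼-⟪⟫ λ' ext)
        vt : valid (θ X · (Φs ⟪ σ ⟫))
        vt = valid-· (≋ᶠ-sym Φσ≋Φλ) (θ X) (subst valid stable vθX)
        t=λy : (θ X · (Φs ⟪ σ ⟫)) =E λ' y
        t=λy = E-trans (=E-· Φσ≋Φλ (θ X)) (E-trans (≡⇒=E (sym stable)) θX=λy)

    block-sound : ∀ {Φs S P str P' Φs' S'} → SBlock Φs S P str P' Φs' S' → Φs' ≼ᶠ Φf → S' ⊴ Sf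
                → ∀ {σ} → Tracks σ → WF (dedVars S) P
                → ∃[ σ' ] ( Block (Φs ⟪ σ ⟫) (substᴾ σ P) (map (instAct θ) str) (substᴾ σ' P') (Φs' ⟪ σ' ⟫)
                          × Tracks σ' × (∀ z → z ∈ dedVars S → σ' z ≡ σ z) × WF (dedVars S') P')
    block-sound {Φs} (sb-more {X = X} d _ fresh b) ext suf {σ} tracks wf with SBlock-ext b
    ... | ext₀ , suf₀
        with input-sound {X = X} d (≼-trans ext₀ ext) (⊴-trans suf₀ suf) tracks
           | fresh-input {t = θ X · (Φs ⟪ σ ⟫)} Φs d fresh (proj₂ tracks) wf
    ...   | dτ , recipe , vt , tracks₁ | cont , frame≡ , agree₁ , wf₁ with block-sound b ext suf tracks₁ wf₁
    ...     | σ' , blk , tracks' , agree' , wf' =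
      σ' , b-more dτ recipe vt (Block-cast frame≡ (sym cont) blk) , tracks'
         , (λ z z∈ → trans (agree' z (there (⊴-dedVars (⇒τs-⊴ d) z∈))) (agree₁ z z∈)) , wf'
    block-sound {Φs} (sb-last {X = X} {y} d _ fresh o) ext suf {σ} tracks wf with SOuts-ext o
    ... | ext₀ , suf₀
        with input-sound {X = X} d (≼-trans ext₀ ext) (⊴-trans suf₀ suf) tracks
           | fresh-input {t = θ X · (Φs ⟪ σ ⟫)} Φs d fresh (proj₂ tracks) wf
    ...   | dτ , recipe , vt , tracks₁ | cont , frame≡ , agree₁ , wf₁ =
      update σ y (θ X · (Φs ⟪ σ ⟫))
        , b-last dτ recipe vt (Outs-cast frame≡ (sym cont) (outs-sound o ext suf (proj₁ tracks₁)))
        , tracks₁ , agree₁ , SOuts-WF o wf₁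

    improper-sound : ∀ {Φs S P str S'} → SImproper Φs S P str S' → Φs ≼ᶠ Φf → S' ⊴ Sf
                   → ∀ {σ} → Tracks σ → WF (dedVars S) P
                   → Improper (Φs ⟪ σ ⟫) (substᴾ σ P) (map (instAct θ) str)
    improper-sound {Φs} (si-more {X = X} d _ fresh i) ext suf {σ} tracks wf
      with input-sound {X = X} d ext (⊴-trans (SImproper-⊴ i) suf) tracks
         | fresh-input {t = θ X · (Φs ⟪ σ ⟫)} Φs d fresh (proj₂ tracks) wf
    ... | dτ , recipe , vt , tracks₁ | cont , frame≡ , _ , wf₁ =
      i-more dτ recipe vt (Improper-cast frame≡ (sym cont) (improper-sound i ext suf tracks₁ wf₁))
    improper-sound {Φs} (si-last {X = X} d _ fresh end) ext suf {σ} tracks wf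
      with input-sound {X = X} d ext (⊴-trans (SEnd-⊴ end) suf) tracks
         | fresh-input {t = θ X · (Φs ⟪ σ ⟫)} Φs d fresh (proj₂ tracks) wf
    ... | dτ , recipe , vt , (σ₁≋λ , _) | cont , _ , _ , _ = i-last dτ recipe vt (concrete-end end)
      where
        concrete-end : _ → _
        concrete-end (inj₁ d') = inj₁ (subst (_⇒τ nil) (sym cont) (⇒τs-sound d' (satisfied suf) σ₁≋λ))
        concrete-end (inj₂ (_ , _ , _ , d')) =
          inj₂ (_ , _ , _ , subst (_⇒τ _) (sym cont) (⇒τs-sound d' (satisfied suf) σ₁≋λ))

    trace-sound : ∀ {Ps Φs S str Ps' Φs' S'} → (Ps , Φs , S) ⟶cs[ str ] (Ps' , Φs' , S') → Φs' ≼ᶠ Φf → S' ⊴ Sf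
                → ∀ {σ} → Tracks σ → All (WF (dedVars S)) Ps
                → ∃[ σ' ] ( (map (substᴾ σ) Ps , Φs ⟪ σ ⟫)
                              ⟶c[ map (instAct θ) str ] (map (substᴾ σ') Ps' , Φs' ⟪ σ' ⟫)
                          × Tracks σ')
    trace-sound cs-done _ _ {σ} tracks _ = σ , c-done , tracks
    trace-sound (cs-proper {Ls} {P} {Rs} {tr₁ = tr₁} {tr₂ = tr₂} b rest) ext suf {σ} tracks wf with ⟶cs-ext rest
    ... | ext₀ , suf₀ with Allₚ.++⁻ Ls wf
    ...   | _ , wP ∷ _ with block-sound b (≼-trans ext₀ ext) (⊴-trans suf₀ suf) tracks wP
    ...     | σ₁ , blk , tracks₁ , agree₁ , wf₁
        with trace-sound rest ext suf tracks₁ (WF-replace Ls (⊴-dedVars (proj₂ (SBlock-ext b))) wf wf₁)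
    ...       | σ' , rest' , tracks' =
      σ' , subst₂ (λ Xs tr → (Xs , _) ⟶c[ tr ] _)
                  (sym (map-++ (substᴾ σ) Ls (P ∷ Rs))) (sym (map-++ (instAct θ) tr₁ tr₂))
                  (c-proper blk (subst (λ Xs → (Xs , _) ⟶c[ _ ] _) (map-substᴾ-replace Ls agree₁ wf) rest'))
         , tracks'
    trace-sound (cs-improper {Ls} {P} {Rs} i) ext suf {σ} tracks wf with Allₚ.++⁻ Ls wf
    ... | _ , wP ∷ _ =
      σ , subst₂ (λ Xs Ys → (Xs , _) ⟶c[ _ ] (Ys , _))
                 (sym (map-++ (substᴾ σ) Ls (P ∷ Rs))) (sym (map-++ (substᴾ σ) Ls Rs))
                 (c-improper (improper-sound i ext suf tracks wP))
        , tracks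

  module Completeness (θ : SVar → T) where

    SatC-≼ : ∀ {Φ Φ' σ} → Φ ≼ᶠ Φ' → ∀ C → Scoped Φ C → SatC Φ θ σ C → SatC Φ' θ σ C
    SatC-≼ {Φ} {Φ'} {σ} ext (ded D X x) D⊆Φ s =
      subst (λ a → Recipe D (θ X) × valid (σ x) × valid a × a =E σ x) (sym stable) s
      where
        stable : θ X · (Φ' ⟪ σ ⟫) ≡ θ X · (Φ ⟪ σ ⟫)
        stable = ·-≼ (proj₁ s) (λ {w} → subst (w ∈_) (sym (dom-⟪⟫ Φ σ)) ∘ D⊆Φ) (≼-⟪⟫ σ ext)
    SatC-≼ ext (eqc u v)  _ s = s
    SatC-≼ ext (neqc u v) _ s = s

    SatC-update : ∀ {Φ σ y t} → All (λ p → ¬ Sub (var y) (proj₂ p)) Φ → ∀ C → ¬ VarIn y C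
                → SatC Φ θ σ C → SatC Φ θ (update σ y t) C
    SatC-update {Φ} {σ} {y} {t} y∉Φ (ded D X x) y≢x =
      subst₂ (λ a F → Recipe D (θ X) × valid a × valid (θ X · F) × (θ X · F) =E a)
             (sym (update-≢ σ {y} t y≢x)) (sym (⟪⟫-update Φ y∉Φ))
    SatC-update y∉Φ (eqc u v) y∉ =
      subst₂ (λ a b → valid a × valid b × a =E b)
             (sym (⟨⟩-update u (y∉ ∘ inj₁))) (sym (⟨⟩-update v (y∉ ∘ inj₂)))
    SatC-update y∉Φ (neqc u v) y∉ =
      subst₂ (λ a b → ¬ (valid a × valid b × a =E b))
             (sym (⟨⟩-update u (y∉ ∘ inj₁))) (sym (⟨⟩-update v (y∉ ∘ inj₂)))

    PartialSol : Fr → List Constr → (Var → T) → Set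
    PartialSol Φ S σ = IsSol Φ S θ σ × All (Scoped Φ) S × All (NoHdls ∘ proj₂) Φ

    PartialSol-τ : ∀ {Φ A B σ} → A ⇒τs B → All (SatC Φ θ σ) (proj₂ B) → PartialSol Φ (proj₂ A) σ
                 → PartialSol Φ (proj₂ B) σ
    PartialSol-τ d sat' ((g , _ , fv) , scoped , nh) = (g , sat' , fv) , ⇒τs-All (λ _ _ → tt) (λ _ _ → tt) d scoped , nh

    PartialSol-output : ∀ {Φ S σ w u} → w ∉ dom Φ → valid (u ⟨ σ ⟩) → NoHdls u → PartialSol Φ S σ
                      → PartialSol ((w , u) ∷ Φ) S σ
    PartialSol-output w∉ vu nh ((g , sat , fv) , scoped , nhs) =
        (g , All.zipWith (λ {C} p → SatC-≼ ext C (proj₂ p) (proj₁ p)) (sat , scoped) , vu ∷ fv)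
      , All.map (λ {C} → Scoped-≼ ext C) scoped , nh ∷ nhs
      where
        ext = ≼-cons w∉ ≼-refl

    input-complete : ∀ {c x Qc Φs P S σ X rest} → substᴾ σ P ⇒τ inp c x Qc
                   → Recipe (dom (Φs ⟪ σ ⟫)) (θ X) → valid (θ X · (Φs ⟪ σ ⟫))
                   → PartialSol Φs S σ → FreshInputs (sinA c X ∷ rest) S
                   → ∃[ Q ] ∃[ S₁ ] let y = freshVar Φs S₁ Q ; S₂ = ded (dom Φs) X y ∷ S₁ in
                       (P , S) ⇒τs (inp c x Q , S₁) × Qc ≡ substᴾ (update σ x (var x)) Q
                     × FreshSV X S₁ × FreshV y Φs S₁ Q
                     × PartialSol Φs S₂ (update σ y (θ X · (Φs ⟪ σ ⟫))) × FreshInputs rest S₂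
    input-complete {Φs = Φs} {P} {S} {σ} {X} {rest} d recipe vt ((g , sat , fv) , scoped , nh) (X∉rest ∷ uniq , fX ∷ frest)
      with ⇒τ-complete d P S refl sat
    ... | P' , S₁ , dτ , e , sat₁ with substᴾ-inp⁻ P' (sym e)
    ...   | Q , refl , Qc≡ = Q , S₁ , dτ , Qc≡ , FreshSV-τ dτ fX , fresh , inv' , fresh-rest
      where
        y = freshVar Φs S₁ Q
        fresh = freshVar-FreshV Φs S₁ Q
        t = θ X · (Φs ⟪ σ ⟫)
        frame≡ : Φs ⟪ update σ y t ⟫ ≡ Φs ⟪ σ ⟫
        frame≡ = ⟪⟫-update Φs (proj₁ fresh)
        ded-sat : SatC Φs θ (update σ y t) (ded (dom Φs) X y)
        ded-sat = Recipe-mono (λ {w} → subst (w ∈_) (dom-⟪⟫ Φs σ)) recipe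
                , subst valid (sym (update-≡ σ y t)) vt
                , subst (λ F → valid (θ X · F)) (sym frame≡) vt
                , ≡⇒=E (trans (cong (θ X ·_) frame≡) (sym (update-≡ σ y t)))
        inv' : PartialSol Φs (ded (dom Φs) X y ∷ S₁) (update σ y t)
        inv' = ( update-pointwise {P = λ _ → Ground} {y = y} (ground-· recipe (ground-⟪⟫ Φs nh g)) g
               , ded-sat ∷ All.zipWith (λ {C} p → SatC-update (proj₁ fresh) C (proj₂ p) (proj₁ p))
                                       (sat₁ , proj₁ (proj₂ fresh))
               , All.zipWith (λ {p} q → subst valid (sym (⟨⟩-update (proj₂ p) (proj₂ q))) (proj₁ q))
                             (fv , proj₁ fresh) )
             , id ∷ ⇒τs-All (λ _ _ → tt) (λ _ _ → tt) dτ scoped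
             , nh
        fresh-rest : FreshInputs rest (ded (dom Φs) X y ∷ S₁)
        fresh-rest = uniq , All.zipWith (λ p → ≢-sym (proj₁ p) ∷ FreshSV-τ dτ (proj₂ p)) (X∉rest , frest)

    sat-of : ∀ {Φ S σ} → PartialSol Φ S σ → All (SatC Φ θ σ) S
    sat-of ((_ , sat , _) , _) = sat

    noVars-of : ∀ {Φ S σ} → PartialSol Φ S σ → ∀ z → NoVars (σ z)
    noVars-of ((ground , _) , _) z = proj₁ (ground z)

    outs-complete : ∀ {Φs S P σ} str {rest P'c Φc'} → Outs (Φs ⟪ σ ⟫) (substᴾ σ P) (map (instAct θ) str) P'c Φc'
                  → PartialSol Φs S σ → WF (dedVars S) P → FreshInputs (str ++ rest) S
                  → ∃[ P' ] ∃[ Φs' ] ∃[ S' ]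
                            ( SOuts Φs S P str P' Φs' S' × P'c ≡ substᴾ σ P' × Φc' ≡ Φs' ⟪ σ ⟫
                                            × PartialSol Φs' S' σ × WF (dedVars S') P' × FreshInputs rest S')
    outs-complete {S = S} {P} [] {rest} (o-nil d) inv wf fresh with ⇒τ-complete d P S refl (sat-of inv)
    ... | P' , S₁ , dτ , e , sat₁ with substᴾ-nil⁻ P' (sym e)
    ...   | refl = nil , _ , S₁ , so-nil dτ , refl , refl , PartialSol-τ dτ sat₁ inv , tt
                 , FreshInputs-mono rest (FreshSV-τ dτ) fresh
    outs-complete {S = S} {P} [] {rest} (o-in d) inv wf fresh with ⇒τ-complete d P S refl (sat-of inv)
    ... | P' , S₁ , dτ , e , sat₁ with substᴾ-inp⁻ P' (sym e)
    ...   | Q , refl , refl = inp _ _ Q , _ , S₁ , so-in dτ , refl , refl , PartialSol-τ dτ sat₁ inv , ⇒τs-WF dτ wf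
                            , FreshInputs-mono rest (FreshSV-τ dτ) fresh
    outs-complete {Φs} {S} {P} {σ} [] {rest} (o-blk d invalid) inv wf fresh with ⇒τ-complete d P S refl (sat-of inv)
    ... | P' , S₁ , dτ , e , sat₁ with substᴾ-out⁻ P' (sym e)
    ...   | u , Q , refl , refl , refl =
      out _ u Q , _ , neqc u u ∷ S₁ , so-blk dτ , refl , refl , blocked (PartialSol-τ dτ sat₁ inv) , ⇒τs-WF dτ wf
        , FreshInputs-mono rest (λ f → (λ ()) ∷ FreshSV-τ dτ f) fresh
      where
        blocked : PartialSol Φs S₁ σ → PartialSol Φs (neqc u u ∷ S₁) σ
        blocked ((g , sat , fv) , scoped , nh) = (g , (λ (vu , _) → invalid vu) ∷ sat , fv) , tt ∷ scoped , nh
    outs-complete {Φs} {S} {P} {σ} (soutA c w ∷ str) {rest} (o-step d vu w∉ o) inv wf fresh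
      with ⇒τ-complete d P S refl (sat-of inv)
    ... | P' , S₁ , dτ , e , sat₁ with substᴾ-out⁻ P' (sym e)
    ...   | u , Q , refl , refl , refl with ⇒τs-WF dτ wf
    ...     | (_ , u-noHdls) , wfQ
        with outs-complete str o
               (PartialSol-output (w∉ ∘ subst (w ∈_) (sym (dom-⟪⟫ Φs σ))) vu u-noHdls (PartialSol-τ dτ sat₁ inv))
                           wfQ (FreshInputs-mono (str ++ rest) (FreshSV-τ dτ) fresh)
    ...       | P'' , Φs' , S' , so , eP , eΦ , inv' , wf' , fresh' =
      P'' , Φs' , S' , so-step dτ (w∉ ∘ subst (w ∈_) (sym (dom-⟪⟫ Φs σ))) so , eP , eΦ , inv' , wf' , fresh'

    block-complete : ∀ {Φs S P σ} str {rest P'c Φc'} → Block (Φs ⟪ σ ⟫) (substᴾ σ P) (map (instAct θ) str) P'c Φc'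
                   → PartialSol Φs S σ → WF (dedVars S) P → FreshInputs (str ++ rest) S
                   → ∃[ P' ] ∃[ Φs' ] ∃[ S' ] ∃[ σ' ]
                       ( SBlock Φs S P str P' Φs' S' × P'c ≡ substᴾ σ' P' × Φc' ≡ Φs' ⟪ σ' ⟫
                       × PartialSol Φs' S' σ' × WF (dedVars S') P' × FreshInputs rest S'
                       × (∀ z → z ∈ dedVars S → σ' z ≡ σ z))
    block-complete {Φs} {σ = σ} (sinA c X ∷ str) {rest} (b-more d recipe vt b) inv wf fresh
      with input-complete {rest = str ++ rest} d recipe vt inv fresh
    ... | Q , S₁ , dτ , refl , fX , fy , inv₁ , fresh₁
      with fresh-input {t = θ X · (Φs ⟪ σ ⟫)} Φs dτ fy (noVars-of inv) wf
    ...   | cont , frame≡ , agree₁ , wf₁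
      with block-complete str {rest} (Block-cast (sym frame≡) cont b) inv₁ wf₁ fresh₁
    ...     | P' , Φs' , S' , σ' , sb , eP , eΦ , inv' , wf' , fresh' , agree' =
      P' , Φs' , S' , σ' , sb-more dτ fX fy sb , eP , eΦ , inv' , wf' , fresh'
         , (λ z z∈ → trans (agree' z (there (⊴-dedVars (⇒τs-⊴ dτ) z∈))) (agree₁ z z∈))
    block-complete {Φs} {σ = σ} (sinA c X ∷ str) {rest} (b-last d recipe vt o) inv wf fresh
      with input-complete {rest = str ++ rest} d recipe vt inv fresh
    ... | Q , S₁ , dτ , refl , fX , fy , inv₁ , fresh₁
      with fresh-input {t = θ X · (Φs ⟪ σ ⟫)} Φs dτ fy (noVars-of inv) wf
    ...   | cont , frame≡ , agree₁ , wf₁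
      with outs-complete str {rest} (Outs-cast (sym frame≡) cont o) inv₁ wf₁ fresh₁
    ...     | P' , Φs' , S' , so , eP , eΦ , inv' , wf' , fresh' =
      P' , Φs' , S' , _ , sb-last dτ fX fy so , eP , eΦ , inv' , wf' , fresh' , agree₁

    end-complete : ∀ {Φ P S σ Pc} → Pc ≡ substᴾ σ P
                 → (Pc ⇒τ nil) ⊎ ∃[ c ] ∃[ u ] ∃[ R ] (Pc ⇒τ out c u R) → PartialSol Φ S σ
                 → ∃[ S' ] (SEnd (P , S) S' × IsSol Φ S' θ σ)
    end-complete {P = P} {S} e (inj₁ d) ((g , sat , fv) , _) with ⇒τ-complete d P S e sat
    ... | P' , S' , dτ , e' , sat' with substᴾ-nil⁻ P' (sym e')
    ...   | refl = S' , inj₁ dτ , (g , sat' , fv)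
    end-complete {P = P} {S} e (inj₂ (_ , _ , _ , d)) ((g , sat , fv) , _) with ⇒τ-complete d P S e sat
    ... | P' , S' , dτ , e' , sat' with substᴾ-out⁻ P' (sym e')
    ...   | _ , _ , refl , _ , _ = S' , inj₂ (_ , _ , _ , dτ) , (g , sat' , fv)

    improper-complete : ∀ {Φs S P σ} str → Improper (Φs ⟪ σ ⟫) (substᴾ σ P) (map (instAct θ) str)
                      → PartialSol Φs S σ → WF (dedVars S) P → FreshInputs str S
                      → ∃[ S' ] ∃[ σ' ]
                          (SImproper Φs S P str S' × Φs ⟪ σ ⟫ ≡ Φs ⟪ σ' ⟫ × IsSol Φs S' θ σ')
    improper-complete {Φs} {σ = σ} (sinA c X ∷ []) (i-last d recipe vt end) inv wf fresh
      with input-complete {rest = []} d recipe vt inv fresh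
    ... | Q , S₁ , dτ , refl , fX , fy , inv₁ , _
      with fresh-input {t = θ X · (Φs ⟪ σ ⟫)} Φs dτ fy (noVars-of inv) wf
    ...   | cont , frame≡ , _ , _ with end-complete cont end inv₁
    ...     | S' , end' , sol = S' , _ , si-last dτ fX fy end' , sym frame≡ , sol

    improper-complete {Φs} {σ = σ} (sinA c X ∷ str) (i-more d recipe vt i) inv wf fresh
      with input-complete {rest = str} d recipe vt inv fresh
    ... | Q , S₁ , dτ , refl , fX , fy , inv₁ , fresh₁
      with fresh-input {t = θ X · (Φs ⟪ σ ⟫)} Φs dτ fy (noVars-of inv) wf
    ...   | cont , frame≡ , _ , wf₁ with improper-complete str (Improper-cast (sym frame≡) cont i) inv₁ wf₁ fresh₁
    ...     | S' , σ' , si , eΦ , sol = S' , σ' , si-more dτ fX fy si , trans (sym frame≡) eΦ , sol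
    trace-complete : ∀ {Pcs Φs σ ctr Pcs' Φc'} → (Pcs , Φs ⟪ σ ⟫) ⟶c[ ctr ] (Pcs' , Φc')
                   → ∀ str → ctr ≡ map (instAct θ) str
                   → ∀ {Ps S} → Pcs ≡ map (substᴾ σ) Ps → PartialSol Φs S σ → All (WF (dedVars S)) Ps
                   → FreshInputs str S
                   → ∃[ Ps' ] ∃[ Φs' ] ∃[ S' ] ∃[ σ' ]
                       ((Ps , Φs , S) ⟶cs[ str ] (Ps' , Φs' , S') × IsSol Φs' S' θ σ' × Φc' ≡ Φs' ⟪ σ' ⟫)
    trace-complete {Φs = Φs} {σ} c-done [] refl {Ps} {S} refl inv _ _ = Ps , Φs , S , σ , cs-done , proj₁ inv , refl
    trace-complete {σ = σ} (c-proper {Ls} {Pc} {Rs} {tr₁ = tr₁} {tr₂ = tr₂} b rest) str ctr≡ {Ps} ePs inv wf fresh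
      with map-++⁻ (instAct θ) str {tr₁} {tr₂} ctr≡ | map-++-∷⁻ (substᴾ σ) Ps {Ls} {Pc} {Rs} ePs
    ... | str₁ , str₂ , refl , refl , refl | Ls' , P , Rs' , refl , refl , refl , refl with Allₚ.++⁻ Ls' wf
    ...   | _ , wP ∷ _ with block-complete str₁ b inv wP fresh
    ...     | P' , Φs₁ , S₁ , σ₁ , sb , refl , refl , inv₁ , wf₁ , fresh₁ , agree₁
      with trace-complete rest str₂ refl {Ls' ++ P' ∷ Rs'} (sym (map-substᴾ-replace Ls' agree₁ wf)) inv₁
             (WF-replace Ls' (⊴-dedVars (proj₂ (SBlock-ext sb))) wf wf₁) fresh₁
    ...       | Ps' , Φs' , S' , σ' , tr , sol , eΦ = Ps' , Φs' , S' , σ' , cs-proper sb tr , sol , eΦ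
    trace-complete {Φs = Φs} {σ} (c-improper {Ls} {Pc} {Rs} i) str refl {Ps} ePs inv wf fresh
      with map-++-∷⁻ (substᴾ σ) Ps {Ls} {Pc} {Rs} ePs
    ... | Ls' , P , Rs' , refl , refl , refl , refl with Allₚ.++⁻ Ls' wf
    ...   | _ , wP ∷ _ with improper-complete str i inv wP fresh
    ...     | S' , σ' , si , eΦ , sol = Ls' ++ Rs' , Φs , S' , σ' , cs-improper si , sol , eΦ

  -- The two inclusions

  a₀-term : T
  a₀-term = app a₀ (subst (Vec T) (sym a₀-const) [])

  ground-a₀ : Ground a₀-term
  ground-a₀ = (λ x → no-atom (var-atom x)) , (λ w → no-atom (hdl-atom w))
    where
      no-argument : ∀ {n} (e : 0 ≡ n) {t : T} → ¬ t ∈ᵥ subst (Vec T) e []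
      no-argument refl ()
      no-atom : ∀ {a} → Atom a → ¬ Sub a a₀-term
      no-atom (var-atom _) (there t∈ _) = no-argument (sym a₀-const) t∈
      no-atom (hdl-atom _) (there t∈ _) = no-argument (sym a₀-const) t∈

  skeleton : ℕ → List Act → List SAct
  skeleton k []                = []
  skeleton k (inA c M ∷ tr)  = sinA c k ∷ skeleton (suc k) tr
  skeleton k (outA c w ∷ tr) = soutA c w ∷ skeleton k tr

  -- a₀-term is a junk value for names that no input of the trace carries.
  recipeAt : ℕ → List Act → SVar → T
  recipeAt k []                X = a₀-term
  recipeAt k (inA c M ∷ tr)  X = if does (k ≟ X) then M else recipeAt (suc k) tr X
  recipeAt k (outA c w ∷ tr) X = recipeAt k tr X

  skeleton-instAct : ∀ k tr θ → (∀ X → k ≤ X → θ X ≡ recipeAt k tr X) → map (instAct θ) (skeleton k tr) ≡ tr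
  skeleton-instAct k []                θ agree = refl
  skeleton-instAct k (inA c M ∷ tr)  θ agree =
    cong₂ _∷_ (cong (inA c) (trans (agree k ≤-refl) (if-≟-≡ k M _)))
              (skeleton-instAct (suc k) tr θ λ X k<X →
                trans (agree X (≤-trans (n≤1+n k) k<X)) (if-≟-≢ M _ (λ k≡X → <-irrefl k≡X k<X)))
  skeleton-instAct k (outA c w ∷ tr) θ agree = cong (outA c w ∷_) (skeleton-instAct k tr θ agree)

  skeleton-≥ : ∀ k tr → All (k ≤_) (inputVars (skeleton k tr))
  skeleton-≥ k []                = []
  skeleton-≥ k (inA c M ∷ tr)  = ≤-refl ∷ All.map (≤-trans (n≤1+n k)) (skeleton-≥ (suc k) tr)
  skeleton-≥ k (outA c w ∷ tr) = skeleton-≥ k tr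

  skeleton-unique : ∀ k tr → Unique (inputVars (skeleton k tr))
  skeleton-unique k []                = []
  skeleton-unique k (inA c M ∷ tr)  =
    All.map (λ k<X k≡X → <-irrefl k≡X k<X) (skeleton-≥ (suc k) tr) ∷ skeleton-unique (suc k) tr
  skeleton-unique k (outA c w ∷ tr) = skeleton-unique k tr

  trace-skeleton : ∀ tr → ∃[ str ] ∃[ θ ] (map (instAct θ) str ≡ tr × FreshInputs str [])
  trace-skeleton tr =
      skeleton 0 tr , recipeAt 0 tr , skeleton-instAct 0 tr (recipeAt 0 tr) (λ _ _ → refl)
    , skeleton-unique 0 tr , All.tabulate (λ _ → [])

  map-substᴾ-closed : ∀ σ {Ps : List Pr} → All Closed Ps → map (substᴾ σ) Ps ≡ Ps
  map-substᴾ-closed σ []       = refl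
  map-substᴾ-closed σ (c ∷ cs) = cong₂ _∷_ (substᴾ-closed σ _ c) (map-substᴾ-closed σ cs)

  symbolic⇒concrete : ∀ {Ps Φ} → All Closed Ps → GroundFrame Φ
                    → ∀ {str Ps' Φ' S} → (Ps , Φ , []) ⟶cs[ str ] (Ps' , Φ' , S)
                    → ∀ θ λ' → IsSol Φ' S θ λ'
                    → ∃[ A' ] ((Ps , Φ) ⟶c[ map (instAct θ) str ] A' × (Φ' ⟪ λ' ⟫) ∼ proj₂ A')
  symbolic⇒concrete {Ps} {Φ} closed ground {str} {Ps'} {Φ'} symb θ λ' sol
    with Soundness.trace-sound θ λ' _ _ sol symb ≼-refl ⊴-refl
           ((λ _ → inj₁ refl) , (λ z → proj₁ (proj₁ sol z))) closed
  ... | σ , conc , (σ≋λ , _) =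
      _ , subst (λ A → A ⟶c[ map (instAct θ) str ] (map (substᴾ σ) Ps' , Φ' ⟪ σ ⟫))
                (cong₂ _,_ (map-substᴾ-closed λ' closed) (⟪⟫-ground Φ ground)) conc
        , ≋ᶠ⇒∼ (≋ᶠ-sym (⟪⟫-≋ᶠ Φ' σ≋λ (proj₂ (proj₂ sol))))

  concrete⇒symbolic : ∀ {Ps Φ} → All Closed Ps → All (λ p → Ground (proj₂ p) × valid (proj₂ p)) Φ
                    → ∀ θ str → FreshInputs str [] → ∀ {A'} → (Ps , Φ) ⟶c[ map (instAct θ) str ] A'
                    → ∃[ Ps' ] ∃[ Φ' ] ∃[ S ] ∃[ λ' ]
                        ((Ps , Φ , []) ⟶cs[ str ] (Ps' , Φ' , S) × IsSol Φ' S θ λ' × proj₂ A' ≡ Φ' ⟪ λ' ⟫)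
  concrete⇒symbolic {Ps} {Φ} closed ok θ str fresh conc =
    Completeness.trace-complete θ (subst (λ F → (Ps , F) ⟶c[ _ ] _) (sym (⟪⟫-ground Φ ground)) conc) str refl
      (sym (map-substᴾ-closed (λ _ → a₀-term) closed)) initial closed fresh
    where
      ground : GroundFrame Φ
      ground = All.map proj₁ ok
      -- A solution must send every variable to a ground term, hence the public constant.
      initial : Completeness.PartialSol θ Φ [] (λ _ → a₀-term)
      initial = ((λ _ → ground-a₀) , [] , All.map (λ {p} (g , v) → subst valid (sym (⟨⟩-ground (proj₂ p) g)) v) ok)
              , [] , All.map (proj₂ ∘ proj₁) ok

  ⊑c⇒⊑cs : ∀ {A B} → ExtSimple A → ExtSimple B → A ⊑c B → A ⊑cs B
  ⊑c⇒⊑cs (_ , closedA , _ , okA) (_ , closedB , _ , okB) A⊑B str _ _ _ symbA θ λA solA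
    with symbolic⇒concrete closedA (All.map proj₁ okA) symbA θ λA solA
  ... | A' , concA , ∼A' with A⊑B _ A' concA
  ...   | B' , concB , A'∼B' with concrete⇒symbolic closedB okB θ str (⟶cs-FreshInputs symbA) concB
  ...     | Q' , Ψ' , SB , λB , symbB , solB , B'≡ =
    Q' , Ψ' , SB , λB , symbB , solB , ∼-trans ∼A' (subst (proj₂ A' ∼_) B'≡ A'∼B')

  ⊑cs⇒⊑c : ∀ {A B} → ExtSimple A → ExtSimple B → A ⊑cs B → A ⊑c B
  ⊑cs⇒⊑c (_ , closedA , _ , okA) (_ , closedB , _ , okB) A⊑B tr A' concA with trace-skeleton tr
  ... | str , θ , refl , fresh with concrete⇒symbolic closedA okA θ str fresh concA
  ...   | P' , Φ' , SA , λA , symbA , solA , A'≡ with A⊑B str P' Φ' SA symbA θ λA solA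
  ...     | Q' , Ψ' , SB , λB , symbB , solB , Φ'∼Ψ' with symbolic⇒concrete closedB (All.map proj₁ okB) symbB θ λB solB
  ...       | B' , concB , Ψ'∼B' = B' , concB , subst (_∼ proj₂ B') (sym A'≡) (∼-trans Φ'∼Ψ' Ψ'∼B')

theorem2 : (𝕊 : Setting) → let open Semantics 𝕊 in
    ∀ (A B : Ext) → ExtSimple A → ExtSimple B → (A ⊑c B) ⇔ (A ⊑cs B)
theorem2 𝕊 A B simpleA simpleB = mk⇔ (⊑c⇒⊑cs 𝕊 simpleA simpleB) (⊑cs⇒⊑c 𝕊 simpleA simpleB)
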